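{- Fix a partition $\lambda\vdash n$. Choose a standard Young tableau $T$ of shape $\lambda$ uniformly at random and, independently, an integer $i\in\{1,\ldots,n+1\}$ uniformly at random. In $T$, replace every entry $k\ge i$ by $k+1$, and then insert $i$ into the resulting tableau by the bumping (row insertion) process of the Robinson–Schensted algorithm. Let $X$ be the content of the square added to $\lambda$ in this process. Then $E(X)=0$ and $\operatorname{Var}(X)=n$.
   Context: The Young diagram of $\lambda$ is $[\lambda]=\{(a,b)\in\mathbb{Z}^2:1\le a\le\ell(\lambda),\ 1\le b\le\lambda_a\}$ with $a$ the row and $b$ the column index. A standard Young tableau of shape $\lambda$ is a bijection $[\lambda]\to\{1,\ldots,n\}$ increasing along rows and down columns. The content of a square $(a,b)$ is $a-b$. Row insertion of a value $v$: insert $v$ into the first row; if some entry exceeds $v$, the smallest such entry is replaced by $v$ and is bumped into the next row, where the same procedure is repeated; otherwise $v$ is placed at the end of the row. The shape grows by exactly one square (an outer corner of $\lambda$). -}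

module Defs where

open import Data.Nat using (ℕ; zero; suc; _<_; _<ᵇ_; _≤ᵇ_)
open import Data.Bool using (if_then_else_)
open import Data.Integer as ℤ using (ℤ; +_; _-_)
open import Data.List using (List; []; _∷_; map; length; concat; upTo; foldr)
open import Data.Nat.ListAction using (sum)
open import Data.List.Relation.Unary.All using (All)
open import Data.List.Relation.Unary.Linked using (Linked)
open import Data.List.Relation.Binary.Permutation.Propositional using (_↭_)
open import Data.Maybe using (Maybe; just; nothing)
open import Data.Product using (_×_; _,_)
open import Relation.Binary.PropositionalEquality using (_≡_)

IsPartition : List ℕ → Set
IsPartition λ' = All (0 <_) λ' × Linked (λ a b → b Data.Nat.≤ a) λ'

-- A tableau is given by its rows (row 1 first).
Tableau : Set
Tableau = List (List ℕ)

-- entry-wise strict increase from an upper row to the row below it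
-- (the lower row is no longer than the upper one)
data ColStrict : List ℕ → List ℕ → Set where
  []  : ∀ {r} → ColStrict r []
  _∷_ : ∀ {x y xs ys} → x < y → ColStrict xs ys → ColStrict (x ∷ xs) (y ∷ ys)

oneTo : ℕ → List ℕ
oneTo n = map suc (upTo n)

IsSYT : List ℕ → Tableau → Set
IsSYT λ' t =
  map length t ≡ λ'
  × All (Linked _<_) t
  × Linked ColStrict t
  × concat t ↭ oneTo (sum λ')

shiftFrom : ℕ → Tableau → Tableau
shiftFrom i = map (map (λ k → if i ≤ᵇ k then suc k else k))

-- insert v into a row: returns the bumped entry (if any), the new row,
-- and the (1-indexed) column where v was placed
bumpRow : ℕ → List ℕ → Maybe ℕ × List ℕ × ℕ
bumpRow v [] = nothing , (v ∷ []) , 1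
bumpRow v (x ∷ xs) with v <ᵇ x
... | Data.Bool.true = just x , (v ∷ xs) , 1
... | Data.Bool.false with bumpRow v xs
...   | m , ys , c = m , (x ∷ ys) , suc c

-- row insertion starting at row index a; returns the new tableau and the
-- (row, column) of the square added to the shape
insertFrom : ℕ → ℕ → Tableau → Tableau × ℕ × ℕ
insertFrom v a [] = ((v ∷ []) ∷ []) , a , 1
insertFrom v a (r ∷ rs) with bumpRow v r
... | nothing , r' , c = (r' ∷ rs) , a , c
... | just w , r' , c with insertFrom w (suc a) rs
...   | rs' , pos = (r' ∷ rs') , pos

-- RS row insertion of v into t (rows indexed from 1)
rsInsert : ℕ → Tableau → Tableau × ℕ × ℕ
rsInsert v t = insertFrom v 1 t

content : ℕ × ℕ → ℤ
content (a , b) = + a - + b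

X : Tableau → ℕ → ℤ
X t i with rsInsert i (shiftFrom i t)
... | _ , pos = content pos

sumℤ : List ℤ → ℤ
sumℤ = foldr ℤ._+_ (+ 0)

sumOver : List Tableau → ℕ → (Tableau → ℕ → ℤ) → ℤ
sumOver ts n f = sumℤ (concat (map (λ t → map (f t) (oneTo (suc n))) ts))

-- Proof by induction on n = |λ|, deleting the largest entry n of a tableau.
-- Let R(T, i) be the 0-indexed row where the insertion of i into shiftFrom i T
-- stops; the added square is (R + 1, λ_R + 1), so X(T, i) = R − λ_R.  If n
-- ends row r of T and S is T without n (an SYT of shape λ − □_r), then for
-- i ≤ n the insertion into T ends in row raise r (R(S, i)) (an insertion
-- stopping in row r now bumps n one row down), and for i = n + 1 in row 0.
-- Summing this over the decomposition SYT(λ) ≅ ⋃_r SYT(λ − □_r) yields, by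
-- induction on n,
--   * the row count: #{(T, i) : the insertion ends in row a} = f^{λ + □_a}
--     if a square can be added in row a, and 0 otherwise;
--   * the moment recursion: Σ φ(X) over λ is Σ_r of the same over λ − □_r
--     plus f^λ times a telescoping sum, giving Σ X = 0, Σ X² = n (n + 1) f^λ.
module Submission where

open import Defs
open import Data.Nat using (ℕ; suc)
open import Data.Integer using (ℤ; +_; _*_; _-_)
open import Data.List using (List; length)
open import Data.Nat.ListAction using (sum)
open import Data.List.Membership.Propositional using (_∈_)
open import Data.List.Relation.Unary.Unique.Propositional using (Unique)
open import Data.Product using (_×_)
open import Function.Bundles using (_⇔_)
open import Relation.Binary.PropositionalEquality using (_≡_)

open import Data.Nat as N using (zero; _<_; _≤_; z≤n; s≤s; _<ᵇ_; _≤ᵇ_; _≡ᵇ_; _≟_)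
import Data.Nat.Properties as NP
open import Data.Bool using (Bool; true; false; if_then_else_; T)
open import Data.Integer using () renaming (_+_ to _+ℤ_)
import Data.Integer.Properties as ZP
open import Data.Integer.Tactic.RingSolver using (solve-∀)
open import Data.List using ([]; _∷_; map; concat; upTo; filter; _++_; [_])
import Data.List.Properties as LP
open import Data.List.Relation.Unary.All as All using (All; []; _∷_)
import Data.List.Relation.Unary.All.Properties as AllP
open import Data.List.Relation.Unary.Any using (Any; here; there)
open import Data.List.Membership.Propositional.Properties
open import Data.List.Relation.Unary.Linked as Linked using (Linked; []; [-]; _∷_)
open import Data.List.Relation.Binary.Permutation.Propositional using (_↭_; ↭-refl; ↭-sym; ↭-trans; prep)
import Data.List.Relation.Binary.Permutation.Propositional.Properties as Perm
open import Data.List.Relation.Binary.BagAndSetEquality using (∼bag⇒↭)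
open import Data.List.Membership.Propositional.Properties.WithK using (unique∧set⇒bag)
open import Data.List.Relation.Unary.Unique.Propositional using ([]; _∷_)
import Data.List.Relation.Unary.Unique.Propositional.Properties as UniqueP
open import Data.Maybe using (just; nothing)
open import Data.Product using (_,_; proj₁; proj₂)
open import Data.Unit using (⊤; tt)
open import Data.Empty using (⊥-elim)
open import Function using (_∘_)
open import Function.Bundles using (mk⇔; Equivalence)
open import Relation.Nullary using (Dec; yes; no; ¬_)
open import Relation.Nullary.Decidable using (⌊_⌋)
open import Relation.Binary.PropositionalEquality using (refl; sym; trans; cong; cong₂; subst; module ≡-Reasoning)

Σl : {A : Set} → List A → (A → ℤ) → ℤ
Σl [] f = + 0
Σl (x ∷ xs) f = f x +ℤ Σl xs f

Σr : ℕ → (ℕ → ℤ) → ℤ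
Σr zero f = + 0
Σr (suc L) f = Σr L f +ℤ f L

private
  interchange : ∀ (a b c d : ℤ) → (a +ℤ b) +ℤ (c +ℤ d) ≡ (a +ℤ c) +ℤ (b +ℤ d)
  interchange = solve-∀

Σl-++ : {A : Set} (xs ys : List A) (f : A → ℤ) → Σl (xs ++ ys) f ≡ Σl xs f +ℤ Σl ys f
Σl-++ [] ys f = sym (ZP.+-identityˡ _)
Σl-++ (x ∷ xs) ys f rewrite Σl-++ xs ys f = sym (ZP.+-assoc (f x) _ _)

Σl-map : {A B : Set} (g : A → B) (xs : List A) (f : B → ℤ) → Σl (map g xs) f ≡ Σl xs (f ∘ g)
Σl-map g [] f = refl
Σl-map g (x ∷ xs) f = cong (f (g x) +ℤ_) (Σl-map g xs f)

Σl-concat : {A : Set} (xss : List (List A)) (f : A → ℤ) → Σl (concat xss) f ≡ Σl xss (λ xs → Σl xs f)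
Σl-concat [] f = refl
Σl-concat (xs ∷ xss) f = trans (Σl-++ xs (concat xss) f) (cong (Σl xs f +ℤ_) (Σl-concat xss f))

Σl-cong : {A : Set} (xs : List A) {f g : A → ℤ} → (∀ x → x ∈ xs → f x ≡ g x) → Σl xs f ≡ Σl xs g
Σl-cong [] h = refl
Σl-cong (x ∷ xs) h = cong₂ _+ℤ_ (h x (here refl)) (Σl-cong xs (λ y m → h y (there m)))

Σl-ext : {A : Set} (xs : List A) {f g : A → ℤ} → (∀ x → f x ≡ g x) → Σl xs f ≡ Σl xs g
Σl-ext xs h = Σl-cong xs (λ x _ → h x)

Σl-+ : {A : Set} (xs : List A) (f g : A → ℤ) → Σl xs (λ x → f x +ℤ g x) ≡ Σl xs f +ℤ Σl xs g
Σl-+ [] f g = refl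
Σl-+ (x ∷ xs) f g rewrite Σl-+ xs f g = interchange (f x) (g x) (Σl xs f) (Σl xs g)

Σl-*ˡ : {A : Set} (xs : List A) (c : ℤ) (f : A → ℤ) → Σl xs (λ x → c * f x) ≡ c * Σl xs f
Σl-*ˡ [] c f = sym (ZP.*-zeroʳ c)
Σl-*ˡ (x ∷ xs) c f rewrite Σl-*ˡ xs c f = sym (ZP.*-distribˡ-+ c (f x) _)

Σl-*ʳ : {A : Set} (xs : List A) (f : A → ℤ) (c : ℤ) → Σl xs (λ x → f x * c) ≡ Σl xs f * c
Σl-*ʳ xs f c = trans (Σl-ext xs (λ x → ZP.*-comm (f x) c)) (trans (Σl-*ˡ xs c f) (ZP.*-comm c _))

Σl-0 : {A : Set} (xs : List A) → Σl xs (λ _ → + 0) ≡ + 0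
Σl-0 [] = refl
Σl-0 (x ∷ xs) rewrite Σl-0 xs = refl

Σl-1 : {A : Set} (xs : List A) → Σl xs (λ _ → + 1) ≡ + length xs
Σl-1 [] = refl
Σl-1 (x ∷ xs) rewrite Σl-1 xs = refl

Σl-+const : {A : Set} (xs : List A) (f : A → ℤ) (c : ℤ) → Σl xs (λ x → f x +ℤ c) ≡ Σl xs f +ℤ c * + length xs
Σl-+const xs f c = begin
    Σl xs (λ x → f x +ℤ c)              ≡⟨ Σl-+ xs f (λ _ → c) ⟩
    Σl xs f +ℤ Σl xs (λ _ → c)          ≡⟨ cong (Σl xs f +ℤ_) (Σl-ext xs (λ _ → sym (ZP.*-identityʳ c))) ⟩
    Σl xs f +ℤ Σl xs (λ _ → c * + 1)    ≡⟨ cong (Σl xs f +ℤ_) (Σl-*ˡ xs c (λ _ → + 1)) ⟩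
    Σl xs f +ℤ c * Σl xs (λ _ → + 1)    ≡⟨ cong (λ k → Σl xs f +ℤ c * k) (Σl-1 xs) ⟩
    Σl xs f +ℤ c * + length xs          ∎
  where open ≡-Reasoning

Σl-unless : {A : Set} (xs : List A) (b : Bool) (f : A → ℤ) →
  Σl xs (λ x → if b then + 0 else f x) ≡ (if b then + 0 else Σl xs f)
Σl-unless xs true f = Σl-0 xs
Σl-unless xs false f = refl

Σl-when : {A : Set} (xs : List A) (b : Bool) (f : A → ℤ) →
  Σl xs (λ x → if b then f x else + 0) ≡ (if b then Σl xs f else + 0)
Σl-when xs true f = refl
Σl-when xs false f = Σl-0 xs

Σl-filter : {A : Set} {P : A → Set} (P? : (x : A) → Dec (P x)) (xs : List A) (f : A → ℤ) →
  Σl (filter P? xs) f ≡ Σl xs (λ x → if ⌊ P? x ⌋ then f x else + 0)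
Σl-filter P? [] f = refl
Σl-filter P? (x ∷ xs) f with P? x
... | yes _ = cong (f x +ℤ_) (Σl-filter P? xs f)
... | no _ = trans (Σl-filter P? xs f) (sym (ZP.+-identityˡ _))

Σr-ext : ∀ L {f g : ℕ → ℤ} → (∀ r → r < L → f r ≡ g r) → Σr L f ≡ Σr L g
Σr-ext zero h = refl
Σr-ext (suc L) h = cong₂ _+ℤ_ (Σr-ext L (λ r p → h r (NP.m<n⇒m<1+n p))) (h L (NP.n<1+n L))

Σr-+ : ∀ L (f g : ℕ → ℤ) → Σr L (λ x → f x +ℤ g x) ≡ Σr L f +ℤ Σr L g
Σr-+ zero f g = refl
Σr-+ (suc L) f g rewrite Σr-+ L f g = interchange (Σr L f) (Σr L g) (f L) (g L)

Σr-*ˡ : ∀ L (c : ℤ) (f : ℕ → ℤ) → Σr L (λ x → c * f x) ≡ c * Σr L f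
Σr-*ˡ zero c f = sym (ZP.*-zeroʳ c)
Σr-*ˡ (suc L) c f rewrite Σr-*ˡ L c f = sym (ZP.*-distribˡ-+ c _ (f L))

Σr-0 : ∀ L → Σr L (λ _ → + 0) ≡ + 0
Σr-0 zero = refl
Σr-0 (suc L) rewrite Σr-0 L = refl

Σr-shift : ∀ L (f : ℕ → ℤ) → Σr (suc L) f ≡ f 0 +ℤ Σr L (λ r → f (suc r))
Σr-shift zero f = trans (ZP.+-identityˡ (f 0)) (sym (ZP.+-identityʳ (f 0)))
Σr-shift (suc L) f rewrite Σr-shift L f = ZP.+-assoc (f 0) _ (f (suc L))

Σl-Σr : {A : Set} (xs : List A) (L : ℕ) (f : A → ℕ → ℤ) →
  Σl xs (λ x → Σr L (f x)) ≡ Σr L (λ r → Σl xs (λ x → f x r))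
Σl-Σr [] L f = sym (Σr-0 L)
Σl-Σr (x ∷ xs) L f rewrite Σl-Σr xs L f = sym (Σr-+ L (f x) (λ r → Σl xs (λ x → f x r)))

≡ᵇ-true : ∀ {x y} → x ≡ y → (x ≡ᵇ y) ≡ true
≡ᵇ-true {zero} refl = refl
≡ᵇ-true {suc x} refl = ≡ᵇ-true {x} refl

≡ᵇ-false : ∀ {x y} → ¬ x ≡ y → (x ≡ᵇ y) ≡ false
≡ᵇ-false {x} {y} ne with x ≡ᵇ y in eq
... | false = refl
... | true = ⊥-elim (ne (NP.≡ᵇ⇒≡ x y (subst T (sym eq) tt)))

<ᵇ-true : ∀ {x v} → v < x → (v <ᵇ x) ≡ true
<ᵇ-true {x} {v} p with v <ᵇ x in eq
... | true = refl
... | false = ⊥-elim (subst T eq (NP.<⇒<ᵇ p))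

<ᵇ-false : ∀ {x v} → x < v → (v <ᵇ x) ≡ false
<ᵇ-false {x} {v} p with v <ᵇ x in eq
... | false = refl
... | true = ⊥-elim (NP.<-asym p (NP.<ᵇ⇒< v x (subst T (sym eq) tt)))

≤ᵇ-true : ∀ {i n} → i ≤ n → (i ≤ᵇ n) ≡ true
≤ᵇ-true {i} {n} p with i ≤ᵇ n in eq
... | true = refl
... | false = ⊥-elim (subst T eq (NP.≤⇒≤ᵇ p))

≤ᵇ-false : ∀ {i n} → n < i → (i ≤ᵇ n) ≡ false
≤ᵇ-false {i} {n} p with i ≤ᵇ n in eq
... | false = refl
... | true = ⊥-elim (NP.<⇒≱ p (NP.≤ᵇ⇒≤ i n (subst T (sym eq) tt)))

n≢1+n : ∀ n → ¬ n ≡ suc n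
n≢1+n n e = NP.<-irrefl e (NP.n<1+n n)

≟-≡ᵇ : ∀ a b → ⌊ a ≟ b ⌋ ≡ (a ≡ᵇ b)
≟-≡ᵇ a b with a ≟ b
... | yes e = sym (≡ᵇ-true e)
... | no ne = sym (≡ᵇ-false ne)

δ : ℕ → ℕ → ℤ
δ x y = if x ≡ᵇ y then + 1 else + 0

Σr-none : ∀ L k (c : ℕ → ℤ) → L ≤ k → Σr L (λ r → if r ≡ᵇ k then c r else + 0) ≡ + 0
Σr-none zero k c _ = refl
Σr-none (suc L) k c q rewrite ≡ᵇ-false {L} {k} (λ e → NP.<-irrefl e q) =
  trans (ZP.+-identityʳ _) (Σr-none L k c (NP.<⇒≤ q))

Σr-δ : ∀ L k (c : ℕ → ℤ) → k < L → Σr L (λ r → if r ≡ᵇ k then c r else + 0) ≡ c k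
Σr-δ zero k c ()
Σr-δ (suc L) k c p with k ≟ L
... | yes refl rewrite ≡ᵇ-true {k} refl = trans (cong (_+ℤ c k) (Σr-none k k c NP.≤-refl)) (ZP.+-identityˡ (c k))
... | no k≢L rewrite ≡ᵇ-false {L} {k} (k≢L ∘ sym) = trans (ZP.+-identityʳ _) (Σr-δ L k c (NP.≤∧≢⇒< (NP.≤-pred p) k≢L))

Σr-split : ∀ L k (f : ℕ → ℤ) → k < L → Σr L f ≡ f k +ℤ Σr L (λ r → if r ≡ᵇ k then + 0 else f r)
Σr-split L k f p = begin
    Σr L f
  ≡⟨ Σr-ext L (λ r _ → split r) ⟩
    Σr L (λ r → (if r ≡ᵇ k then f r else + 0) +ℤ (if r ≡ᵇ k then + 0 else f r))
  ≡⟨ Σr-+ L _ _ ⟩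
    Σr L (λ r → if r ≡ᵇ k then f r else + 0) +ℤ Σr L (λ r → if r ≡ᵇ k then + 0 else f r)
  ≡⟨ cong (_+ℤ Σr L (λ r → if r ≡ᵇ k then + 0 else f r)) (Σr-δ L k f p) ⟩
    f k +ℤ Σr L (λ r → if r ≡ᵇ k then + 0 else f r)
  ∎
  where
  open ≡-Reasoning
  split : ∀ r → f r ≡ (if r ≡ᵇ k then f r else + 0) +ℤ (if r ≡ᵇ k then + 0 else f r)
  split r with r ≡ᵇ k
  ... | true = sym (ZP.+-identityʳ _)
  ... | false = sym (ZP.+-identityˡ _)

sumℤ-Σl : (xs : List ℤ) → sumℤ xs ≡ Σl xs (λ x → x)
sumℤ-Σl [] = refl
sumℤ-Σl (x ∷ xs) = cong (x +ℤ_) (sumℤ-Σl xs)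

sumOver-Σ : (ts : List Tableau) (n : ℕ) (f : Tableau → ℕ → ℤ) →
  sumOver ts n f ≡ Σl ts (λ t → Σl (oneTo (suc n)) (f t))
sumOver-Σ ts n f = begin
    sumℤ (concat (map rowOfValues ts))                       ≡⟨ sumℤ-Σl (concat (map rowOfValues ts)) ⟩
    Σl (concat (map rowOfValues ts)) (λ x → x)               ≡⟨ Σl-concat (map rowOfValues ts) (λ x → x) ⟩
    Σl (map rowOfValues ts) (λ xs → Σl xs (λ x → x))         ≡⟨ Σl-map rowOfValues ts (λ xs → Σl xs (λ x → x)) ⟩
    Σl ts (λ t → Σl (rowOfValues t) (λ x → x))               ≡⟨ Σl-ext ts (λ t → Σl-map (f t) (oneTo (suc n)) (λ x → x)) ⟩
    Σl ts (λ t → Σl (oneTo (suc n)) (f t))                   ∎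
  where
  open ≡-Reasoning
  rowOfValues : Tableau → List ℤ
  rowOfValues t = map (f t) (oneTo (suc n))

oneTo-suc : ∀ n → oneTo (suc n) ≡ oneTo n ++ [ suc n ]
oneTo-suc n = trans (cong (map suc) (sym (LP.upTo-∷ʳ n))) (LP.map-++ suc (upTo n) [ n ])

∈-oneTo⁻ : ∀ {n i} → i ∈ oneTo n → i ≤ n
∈-oneTo⁻ p with ∈-map⁻ suc p
... | j , j∈ , refl = ∈-upTo⁻ j∈

oneTo-perm : ∀ m → oneTo (suc m) ↭ suc m ∷ oneTo m
oneTo-perm m rewrite oneTo-suc m = Perm.++-comm (oneTo m) [ suc m ]

Σl-oneTo-suc : ∀ n (f : ℕ → ℤ) → Σl (oneTo (suc n)) f ≡ Σl (oneTo n) f +ℤ f (suc n)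
Σl-oneTo-suc n f = begin
    Σl (oneTo (suc n)) f                       ≡⟨ cong (λ z → Σl z f) (oneTo-suc n) ⟩
    Σl (oneTo n ++ [ suc n ]) f                ≡⟨ Σl-++ (oneTo n) [ suc n ] f ⟩
    Σl (oneTo n) f +ℤ (f (suc n) +ℤ + 0)       ≡⟨ cong (Σl (oneTo n) f +ℤ_) (ZP.+-identityʳ _) ⟩
    Σl (oneTo n) f +ℤ f (suc n)                ∎
  where open ≡-Reasoning

-- part μ j is the length of row j (0-indexed) of the shape μ, and 0 beyond μ
part : List ℕ → ℕ → ℕ
part [] _ = 0
part (x ∷ xs) zero = x
part (x ∷ xs) (suc j) = part xs j

-- insRow v τ: the (0-indexed) row in which the insertion of v into τ stops
insRow : ℕ → Tableau → ℕ
insRow v [] = 0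
insRow v (r ∷ rs) with proj₁ (bumpRow v r)
... | nothing = 0
... | just w = suc (insRow w rs)

bumpRow-column : ∀ v r → proj₁ (bumpRow v r) ≡ nothing → proj₂ (proj₂ (bumpRow v r)) ≡ suc (length r)
bumpRow-column v [] e = refl
bumpRow-column v (x ∷ xs) e with v <ᵇ x
bumpRow-column v (x ∷ xs) () | true
... | false = cong suc (bumpRow-column v xs e)

insertFrom-position : ∀ v a τ → proj₂ (insertFrom v a τ) ≡ (a N.+ insRow v τ , suc (part (map length τ) (insRow v τ)))
insertFrom-position v a [] = cong (_, 1) (sym (NP.+-identityʳ a))
insertFrom-position v a (r ∷ rs) with bumpRow v r in eq
... | nothing , r' , c = cong₂ _,_ (sym (NP.+-identityʳ a))
        (trans (sym (cong (proj₂ ∘ proj₂) eq)) (bumpRow-column v r (cong proj₁ eq)))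
... | just w , r' , c = trans (insertFrom-position w (suc a) rs)
        (cong (_, suc (part (map length rs) (insRow w rs))) (sym (NP.+-suc a _)))

bumpRow-max : ∀ v r → All (_< v) r → proj₁ (bumpRow v r) ≡ nothing
bumpRow-max v [] _ = refl
bumpRow-max v (x ∷ xs) (p ∷ ps) rewrite <ᵇ-false p = bumpRow-max v xs ps

insRow-max : ∀ v τ → All (All (_< v)) τ → insRow v τ ≡ 0
insRow-max v [] _ = refl
insRow-max v (r ∷ rs) (p ∷ ps) rewrite bumpRow-max v r p = refl

bumpRow-entry : ∀ {P : ℕ → Set} v r {w} → All P r → proj₁ (bumpRow v r) ≡ just w → P w
bumpRow-entry v [] _ ()
bumpRow-entry v (x ∷ xs) (p ∷ ps) e with v <ᵇ x
bumpRow-entry v (x ∷ xs) (p ∷ ps) refl | true = p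
... | false = bumpRow-entry v xs ps e

bumpRow-snoc-just : ∀ v m r {w} → proj₁ (bumpRow v r) ≡ just w → proj₁ (bumpRow v (r ++ [ m ])) ≡ just w
bumpRow-snoc-just v m [] ()
bumpRow-snoc-just v m (x ∷ xs) e with v <ᵇ x
... | true = e
... | false = bumpRow-snoc-just v m xs e

bumpRow-snoc-nothing : ∀ v m r → v < m → proj₁ (bumpRow v r) ≡ nothing → proj₁ (bumpRow v (r ++ [ m ])) ≡ just m
bumpRow-snoc-nothing v m [] p e rewrite <ᵇ-true p = refl
bumpRow-snoc-nothing v m (x ∷ xs) p e with v <ᵇ x
bumpRow-snoc-nothing v m (x ∷ xs) p () | true
... | false = bumpRow-snoc-nothing v m xs p e

addEntry : ℕ → ℕ → Tableau → Tableau
addEntry zero n [] = [ n ] ∷ []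
addEntry zero n (row ∷ rs) = (row ++ [ n ]) ∷ rs
addEntry (suc k) n [] = [ n ] ∷ []
addEntry (suc k) n (row ∷ rs) = row ∷ addEntry k n rs

raise : ℕ → ℕ → ℕ
raise r x = if x ≡ᵇ r then suc r else x

raise-eq : ∀ r → raise r r ≡ suc r
raise-eq r rewrite ≡ᵇ-true {r} refl = refl

raise-neq : ∀ r x → ¬ x ≡ r → raise r x ≡ x
raise-neq r x ne rewrite ≡ᵇ-false ne = refl

-- Inserting v below a new maximum m placed at the end of row k: the path
-- is the same until it stops; if it stopped in row k, it now bumps m and
-- stops one row lower.
insRow-addEntry : ∀ v m k τ → v < m → All (All (_< m)) τ → k ≤ length τ →
  insRow v (addEntry k m τ) ≡ raise k (insRow v τ)
insRow-addEntry v m zero [] p ps q rewrite <ᵇ-true p = refl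
insRow-addEntry v m zero (r ∷ rs) p (pr ∷ ps) q with proj₁ (bumpRow v r) in eq
... | nothing rewrite bumpRow-snoc-nothing v m r p eq | insRow-max m rs ps = refl
... | just w rewrite bumpRow-snoc-just v m r eq = refl
insRow-addEntry v m (suc k) (r ∷ rs) p (pr ∷ ps) (s≤s q) with proj₁ (bumpRow v r) in eq
... | nothing = refl
... | just w rewrite insRow-addEntry w m k rs (bumpRow-entry v r pr eq) ps q with insRow w rs ≡ᵇ k
... | true = refl
... | false = refl

endRow : Tableau → ℕ → ℕ
endRow t i = insRow i (shiftFrom i t)

rowContent : List ℕ → ℕ → ℤ
rowContent μ x = + x - + part μ x

shift : ℕ → ℕ → ℕ
shift i k = if i ≤ᵇ k then suc k else k

shape-map : ∀ (f : ℕ → ℕ) (t : Tableau) → map length (map (map f) t) ≡ map length t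
shape-map f [] = refl
shape-map f (r ∷ rs) = cong₂ _∷_ (LP.length-map f r) (shape-map f rs)

X-endRow : ∀ t i → X t i ≡ rowContent (map length t) (endRow t i)
X-endRow t i rewrite insertFrom-position i 1 (shiftFrom i t) | shape-map (shift i) t =
  dropSuc (+ endRow t i) (+ part (map length t) (endRow t i))
  where
  dropSuc : ∀ (a b : ℤ) → (+ 1 +ℤ a) - (+ 1 +ℤ b) ≡ a - b
  dropSuc = solve-∀

map-addEntry : ∀ (f : ℕ → ℕ) k x t → map (map f) (addEntry k x t) ≡ addEntry k (f x) (map (map f) t)
map-addEntry f zero x [] = refl
map-addEntry f zero x (r ∷ rs) = cong (_∷ map (map f) rs) (LP.map-++ f r [ x ])
map-addEntry f (suc k) x [] = refl
map-addEntry f (suc k) x (r ∷ rs) = cong (map f r ∷_) (map-addEntry f k x rs)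

shiftFrom-id : ∀ i t → All (All (_< i)) t → shiftFrom i t ≡ t
shiftFrom-id i t b = LP.map-id-local (All.map (λ br → LP.map-id-local (All.map fixed br)) b)
  where
  fixed : ∀ {x} → x < i → shift i x ≡ x
  fixed p rewrite ≤ᵇ-false p = refl

shiftFrom-addEntry : ∀ i n k t → i ≤ n → shiftFrom i (addEntry k n t) ≡ addEntry k (suc n) (shiftFrom i t)
shiftFrom-addEntry i n k t p rewrite map-addEntry (shift i) k n t | ≤ᵇ-true p = refl

shiftFrom-bound : ∀ i m t → All (All (_≤ m)) t → All (All (_< suc (suc m))) (shiftFrom i t)
shiftFrom-bound i m t b = AllP.map⁺ (All.map (λ br → AllP.map⁺ (All.map shift-bound br)) b)
  where
  shift-bound : ∀ {x} → x ≤ m → shift i x < suc (suc m)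
  shift-bound {x} p with i ≤ᵇ x
  ... | true = s≤s (s≤s p)
  ... | false = s≤s (NP.m≤n⇒m≤1+n p)

addEntry-bound : ∀ m k t → All (All (_≤ m)) t → All (All (_≤ suc m)) (addEntry k (suc m) t)
addEntry-bound m zero [] _ = (NP.≤-refl ∷ []) ∷ []
addEntry-bound m zero (r ∷ rs) (p ∷ ps) =
  AllP.++⁺ (All.map NP.m≤n⇒m≤1+n p) (NP.≤-refl ∷ []) ∷ All.map (All.map NP.m≤n⇒m≤1+n) ps
addEntry-bound m (suc k) [] _ = (NP.≤-refl ∷ []) ∷ []
addEntry-bound m (suc k) (r ∷ rs) (p ∷ ps) = All.map NP.m≤n⇒m≤1+n p ∷ addEntry-bound m k rs ps

endRow-addEntry : ∀ m k t i → All (All (_≤ m)) t → k ≤ length t → i ≤ suc m →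
  endRow (addEntry k (suc m) t) i ≡ raise k (endRow t i)
endRow-addEntry m k t i b q p rewrite shiftFrom-addEntry i (suc m) k t p =
  insRow-addEntry i (suc (suc m)) k (shiftFrom i t) (s≤s p) (shiftFrom-bound i m t b)
    (subst (k ≤_) (sym (LP.length-map _ t)) q)

endRow-max : ∀ n t → All (All (_≤ n)) t → endRow t (suc n) ≡ 0
endRow-max n t b rewrite shiftFrom-id (suc n) t (All.map (All.map s≤s) b) =
  insRow-max (suc n) t (All.map (All.map s≤s) b)

Σ-endRow-addEntry : ∀ (g : ℕ → ℤ) m k t → All (All (_≤ m)) t → k ≤ length t →
  Σl (oneTo (suc (suc m))) (λ i → g (endRow (addEntry k (suc m) t) i))
  ≡ Σl (oneTo (suc m)) (λ i → g (raise k (endRow t i))) +ℤ g 0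
Σ-endRow-addEntry g m k t b q = trans (Σl-oneTo-suc (suc m) (λ i → g (endRow (addEntry k (suc m) t) i)))
  (cong₂ _+ℤ_
    (Σl-cong (oneTo (suc m)) (λ i i∈ → cong g (endRow-addEntry m k t i b q (∈-oneTo⁻ i∈))))
    (cong g (endRow-max (suc m) (addEntry k (suc m) t) (addEntry-bound m k t b))))

addBox : ℕ → List ℕ → List ℕ
addBox zero [] = [ 1 ]
addBox zero (x ∷ xs) = suc x ∷ xs
addBox (suc a) [] = [ 1 ]
addBox (suc a) (x ∷ xs) = x ∷ addBox a xs

delBox : ℕ → List ℕ → List ℕ
delBox zero [] = []
delBox zero (zero ∷ xs) = xs
delBox zero (suc zero ∷ xs) = xs
delBox zero (suc (suc k) ∷ xs) = suc k ∷ xs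
delBox (suc b) [] = []
delBox (suc b) (x ∷ xs) = x ∷ delBox b xs

Corner : ℕ → List ℕ → Set
Corner r μ = part μ (suc r) < part μ r

Corner? : ∀ r μ → Dec (Corner r μ)
Corner? r μ = part μ (suc r) N.<? part μ r

Addable : ℕ → List ℕ → Set
Addable zero μ = ⊤
Addable (suc a) μ = Corner a μ

Pos : List ℕ → Set
Pos = All (0 <_)

Decr : List ℕ → Set
Decr μ = ∀ j → part μ (suc j) ≤ part μ j

part-beyond : ∀ μ j → length μ ≤ j → part μ j ≡ 0
part-beyond [] j _ = refl
part-beyond (x ∷ μ) (suc j) (s≤s p) = part-beyond μ j p

part-pos⇒< : ∀ μ j → 0 < part μ j → j < length μ
part-pos⇒< [] j ()
part-pos⇒< (x ∷ μ) zero p = s≤s z≤n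
part-pos⇒< (x ∷ μ) (suc j) p = s≤s (part-pos⇒< μ j p)

Corner⇒< : ∀ r μ → Corner r μ → r < length μ
Corner⇒< r μ c = part-pos⇒< μ r (NP.≤-<-trans z≤n c)

Addable⇒≤ : ∀ a μ → Addable a μ → a ≤ length μ
Addable⇒≤ zero μ _ = z≤n
Addable⇒≤ (suc a) μ c = Corner⇒< a μ c

part-addBox-eq : ∀ a μ → a ≤ length μ → part (addBox a μ) a ≡ suc (part μ a)
part-addBox-eq zero [] _ = refl
part-addBox-eq zero (x ∷ μ) _ = refl
part-addBox-eq (suc a) (x ∷ μ) (s≤s p) = part-addBox-eq a μ p

part-addBox-ne : ∀ a μ j → a ≤ length μ → ¬ j ≡ a → part (addBox a μ) j ≡ part μ j
part-addBox-ne zero [] zero _ ne = ⊥-elim (ne refl)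
part-addBox-ne zero [] (suc j) _ ne = refl
part-addBox-ne zero (x ∷ μ) zero _ ne = ⊥-elim (ne refl)
part-addBox-ne zero (x ∷ μ) (suc j) _ ne = refl
part-addBox-ne (suc a) (x ∷ μ) zero _ ne = refl
part-addBox-ne (suc a) (x ∷ μ) (suc j) (s≤s p) ne = part-addBox-ne a μ j p (ne ∘ cong suc)

part-delBox-eq : ∀ b μ → Pos μ → Corner b μ → part (delBox b μ) b ≡ N.pred (part μ b)
part-delBox-eq zero (zero ∷ μ) (() ∷ _) c
part-delBox-eq zero (suc zero ∷ []) _ c = refl
part-delBox-eq zero (suc zero ∷ (y ∷ μ)) (_ ∷ p ∷ _) (s≤s c) = ⊥-elim (NP.<-irrefl refl (NP.<-≤-trans p c))
part-delBox-eq zero (suc (suc k) ∷ μ) _ c = refl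
part-delBox-eq (suc b) (x ∷ μ) (_ ∷ ps) c = part-delBox-eq b μ ps c

part-delBox-ne : ∀ b μ j → Pos μ → Corner b μ → ¬ j ≡ b → part (delBox b μ) j ≡ part μ j
part-delBox-ne zero (zero ∷ μ) j (() ∷ _) c ne
part-delBox-ne zero (suc zero ∷ []) zero _ c ne = ⊥-elim (ne refl)
part-delBox-ne zero (suc zero ∷ []) (suc j) _ c ne = refl
part-delBox-ne zero (suc zero ∷ (y ∷ μ)) j (_ ∷ p ∷ _) (s≤s c) ne = ⊥-elim (NP.<-irrefl refl (NP.<-≤-trans p c))
part-delBox-ne zero (suc (suc k) ∷ μ) zero _ c ne = ⊥-elim (ne refl)
part-delBox-ne zero (suc (suc k) ∷ μ) (suc j) _ c ne = refl
part-delBox-ne (suc b) (x ∷ μ) zero _ c ne = refl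
part-delBox-ne (suc b) (x ∷ μ) (suc j) (_ ∷ ps) c ne = part-delBox-ne b μ j ps c (ne ∘ cong suc)

pos-addBox : ∀ a μ → Pos μ → Pos (addBox a μ)
pos-addBox zero [] _ = s≤s z≤n ∷ []
pos-addBox zero (x ∷ μ) (_ ∷ ps) = s≤s z≤n ∷ ps
pos-addBox (suc a) [] _ = s≤s z≤n ∷ []
pos-addBox (suc a) (x ∷ μ) (p ∷ ps) = p ∷ pos-addBox a μ ps

pos-delBox : ∀ b μ → Pos μ → Pos (delBox b μ)
pos-delBox zero [] _ = []
pos-delBox zero (zero ∷ μ) (_ ∷ ps) = ps
pos-delBox zero (suc zero ∷ μ) (_ ∷ ps) = ps
pos-delBox zero (suc (suc k) ∷ μ) (_ ∷ ps) = s≤s z≤n ∷ ps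
pos-delBox (suc b) [] _ = []
pos-delBox (suc b) (x ∷ μ) (p ∷ ps) = p ∷ pos-delBox b μ ps

part-ext : ∀ α β → Pos α → Pos β → (∀ j → part α j ≡ part β j) → α ≡ β
part-ext [] [] _ _ h = refl
part-ext [] (y ∷ β) _ (q ∷ _) h = ⊥-elim (NP.<-irrefl (h zero) q)
part-ext (x ∷ α) [] (p ∷ _) _ h = ⊥-elim (NP.<-irrefl (sym (h zero)) p)
part-ext (x ∷ α) (y ∷ β) (_ ∷ ps) (_ ∷ qs) h = cong₂ _∷_ (h zero) (part-ext α β ps qs (h ∘ suc))

partition⇒Decr : ∀ μ → IsPartition μ → Decr μ
partition⇒Decr [] _ j = z≤n
partition⇒Decr (x ∷ []) _ zero = z≤n
partition⇒Decr (x ∷ []) _ (suc j) = z≤n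
partition⇒Decr (x ∷ y ∷ μ) (p ∷ ps , q ∷ qs) zero = q
partition⇒Decr (x ∷ y ∷ μ) (p ∷ ps , q ∷ qs) (suc j) = partition⇒Decr (y ∷ μ) (ps , qs) j

Decr⇒partition : ∀ μ → Pos μ → Decr μ → IsPartition μ
Decr⇒partition [] _ _ = [] , []
Decr⇒partition (x ∷ []) ps _ = ps , [-]
Decr⇒partition (x ∷ y ∷ μ) (p ∷ ps) d with Decr⇒partition (y ∷ μ) ps (d ∘ suc)
... | _ , qs = (p ∷ ps) , (d zero ∷ qs)

partition-addBox : ∀ a μ → IsPartition μ → Addable a μ → IsPartition (addBox a μ)
partition-addBox a μ P@(ps , _) ad = Decr⇒partition (addBox a μ) (pos-addBox a μ ps) decr
  where
  D = partition⇒Decr μ P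
  al = Addable⇒≤ a μ ad
  decr : Decr (addBox a μ)
  decr j with suc j ≟ a | j ≟ a
  ... | yes refl | _ rewrite part-addBox-eq (suc j) μ al | part-addBox-ne (suc j) μ j al (n≢1+n j) = ad
  ... | no ne1 | yes refl rewrite part-addBox-eq j μ al | part-addBox-ne j μ (suc j) al ne1 = NP.m≤n⇒m≤1+n (D j)
  ... | no ne1 | no ne2 rewrite part-addBox-ne a μ (suc j) al ne1 | part-addBox-ne a μ j al ne2 = D j

partition-delBox : ∀ b μ → IsPartition μ → Corner b μ → IsPartition (delBox b μ)
partition-delBox b μ P@(ps , _) c = Decr⇒partition (delBox b μ) (pos-delBox b μ ps) decr
  where
  D = partition⇒Decr μ P
  decr : Decr (delBox b μ)
  decr j with suc j ≟ b | j ≟ b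
  ... | yes refl | _ rewrite part-delBox-eq (suc j) μ ps c | part-delBox-ne (suc j) μ j ps c (n≢1+n j) =
        NP.≤-trans NP.pred[n]≤n (D j)
  ... | no ne1 | yes refl rewrite part-delBox-eq j μ ps c | part-delBox-ne j μ (suc j) ps c ne1 =
        NP.<⇒≤pred c
  ... | no ne1 | no ne2 rewrite part-delBox-ne b μ (suc j) ps c ne1 | part-delBox-ne b μ j ps c ne2 = D j

sum-addBox : ∀ a μ → sum (addBox a μ) ≡ suc (sum μ)
sum-addBox zero [] = refl
sum-addBox zero (x ∷ μ) = refl
sum-addBox (suc a) [] = refl
sum-addBox (suc a) (x ∷ μ) = trans (cong (x N.+_) (sum-addBox a μ)) (NP.+-suc x (sum μ))

sum-delBox : ∀ b μ → 0 < part μ b → suc (sum (delBox b μ)) ≡ sum μ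
sum-delBox zero (suc zero ∷ μ) _ = refl
sum-delBox zero (suc (suc k) ∷ μ) _ = refl
sum-delBox (suc b) (x ∷ μ) p = trans (sym (NP.+-suc x _)) (cong (x N.+_) (sum-delBox b μ p))

length-addBox : ∀ a μ → length (addBox a μ) ≤ suc (length μ)
length-addBox zero [] = NP.≤-refl
length-addBox zero (x ∷ μ) = NP.n≤1+n _
length-addBox (suc a) [] = NP.≤-refl
length-addBox (suc a) (x ∷ μ) = s≤s (length-addBox a μ)

length-delBox : ∀ b μ → Pos μ → Corner b μ → b ≤ length (delBox b μ)
length-delBox zero μ _ _ = z≤n
length-delBox (suc b) (x ∷ μ) (_ ∷ ps) c = s≤s (length-delBox b μ ps c)

addBox-delBox : ∀ r μ → IsPartition μ → Corner r μ → addBox r (delBox r μ) ≡ μ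
addBox-delBox r μ (ps , _) c = part-ext _ _ (pos-addBox r _ (pos-delBox r μ ps)) ps same
  where
  same : ∀ j → part (addBox r (delBox r μ)) j ≡ part μ j
  same j with j ≟ r
  ... | yes refl = trans (part-addBox-eq j _ (length-delBox j μ ps c))
                    (trans (cong suc (part-delBox-eq j μ ps c)) (NP.suc-pred (part μ j) {{N.>-nonZero (NP.≤-<-trans z≤n c)}}))
  ... | no ne = trans (part-addBox-ne r _ j (length-delBox r μ ps c) ne) (part-delBox-ne r μ j ps c ne)

corner-addBox : ∀ a μ → a ≤ length μ → Decr μ → Corner a (addBox a μ)
corner-addBox a μ p D rewrite part-addBox-eq a μ p | part-addBox-ne a μ (suc a) p (n≢1+n a ∘ sym) = s≤s (D a)

delBox-addBox : ∀ r μ → IsPartition μ → r ≤ length μ → delBox r (addBox r μ) ≡ μ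
delBox-addBox r μ P@(ps , _) p = part-ext _ _ (pos-delBox r _ (pos-addBox r μ ps)) ps same
  where
  c = corner-addBox r μ p (partition⇒Decr μ P)
  same : ∀ j → part (delBox r (addBox r μ)) j ≡ part μ j
  same j with j ≟ r
  ... | yes refl = trans (part-delBox-eq j _ (pos-addBox j μ ps) c) (cong N.pred (part-addBox-eq j μ p))
  ... | no ne = trans (part-delBox-ne r _ j (pos-addBox r μ ps) c ne) (part-addBox-ne r μ j p ne)

addable-delBox : ∀ r μ → IsPartition μ → Corner r μ → Addable r (delBox r μ)
addable-delBox zero μ P c = tt
addable-delBox (suc r) μ P@(ps , _) c
  rewrite part-delBox-eq (suc r) μ ps c | part-delBox-ne (suc r) μ r ps c (n≢1+n r) =
  NP.<-≤-trans (pred< (NP.≤-<-trans z≤n c)) (partition⇒Decr μ P r)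
  where
  pred< : ∀ {k} → 0 < k → N.pred k < k
  pred< {suc k} _ = NP.n<1+n k

part-addBox-≥ : ∀ a μ j → a ≤ length μ → part μ j ≤ part (addBox a μ) j
part-addBox-≥ a μ j p with j ≟ a
... | yes refl rewrite part-addBox-eq j μ p = NP.n≤1+n _
... | no ne rewrite part-addBox-ne a μ j p ne = NP.≤-refl

part-delBox-≤ : ∀ b μ j → Pos μ → Corner b μ → part (delBox b μ) j ≤ part μ j
part-delBox-≤ b μ j ps c with j ≟ b
... | yes refl rewrite part-delBox-eq j μ ps c = NP.pred[n]≤n
... | no ne rewrite part-delBox-ne b μ j ps c ne = NP.≤-refl

addable-delBox⇒addable : ∀ r a μ → Pos μ → Corner r μ → ¬ r ≡ a → Addable a (delBox r μ) → Addable a μ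
addable-delBox⇒addable r zero μ ps c ne ad = tt
addable-delBox⇒addable r (suc a) μ ps c ne ad =
  subst (_< part μ a) (part-delBox-ne r μ (suc a) ps c (ne ∘ sym)) (NP.<-≤-trans ad (part-delBox-≤ r μ a ps c))

corner-addBox⇒corner : ∀ β a μ → IsPartition μ → ¬ β ≡ a → Addable a μ → Corner β (addBox a μ) →
  Corner β μ × Addable a (delBox β μ)
corner-addBox⇒corner β a μ (ps , _) ne ad c' = cβ , addable a al ad ne c'
  where
  al = Addable⇒≤ a μ ad
  cβ : Corner β μ
  cβ = NP.≤-<-trans (part-addBox-≥ a μ (suc β) al) (subst (part (addBox a μ) (suc β) <_) (part-addBox-ne a μ β al ne) c')
  addable : ∀ a → a ≤ length μ → Addable a μ → ¬ β ≡ a → Corner β (addBox a μ) → Addable a (delBox β μ)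
  addable zero _ _ _ _ = tt
  addable (suc a) al ad ne c' with a ≟ β
  ... | yes refl rewrite part-delBox-eq a μ ps cβ | part-delBox-ne a μ (suc a) ps cβ (n≢1+n a ∘ sym) =
        NP.suc[m]≤n⇒m≤pred[n] (subst (_< part μ a) (part-addBox-eq (suc a) μ al)
          (subst (part (addBox (suc a) μ) (suc a) <_) (part-addBox-ne (suc a) μ a al (n≢1+n a)) c'))
  ... | no ne' rewrite part-delBox-ne β μ a ps cβ ne' | part-delBox-ne β μ (suc a) ps cβ (ne ∘ sym) = ad

corner⇒corner-addBox : ∀ β a μ → Pos μ → ¬ β ≡ a → Corner β μ → Addable a (delBox β μ) → a ≤ length μ →
  Corner β (addBox a μ)
corner⇒corner-addBox β a μ ps ne c ad al rewrite part-addBox-ne a μ β al ne with suc β ≟ a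
... | yes refl rewrite part-addBox-eq (suc β) μ al =
      NP.m≤pred[n]⇒suc[m]≤n {{N.>-nonZero (NP.≤-<-trans z≤n c)}} (subst (_< N.pred (part μ β)) (part-delBox-ne β μ (suc β) ps c (n≢1+n β ∘ sym))
                   (subst (part (delBox β μ) (suc β) <_) (part-delBox-eq β μ ps c) ad))
... | no ne' rewrite part-addBox-ne a μ (suc β) al ne' = c

delBox-addBox-comm : ∀ β a μ → IsPartition μ → ¬ β ≡ a → Addable a μ → Corner β (addBox a μ) →
  delBox β (addBox a μ) ≡ addBox a (delBox β μ)
delBox-addBox-comm β a μ P@(ps , _) ne ad c' =
  part-ext _ _ (pos-delBox β _ (pos-addBox a μ ps)) (pos-addBox a _ (pos-delBox β μ ps)) same
  where
  al = Addable⇒≤ a μ ad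
  cl = corner-addBox⇒corner β a μ P ne ad c'
  cβ = proj₁ cl
  al' = Addable⇒≤ a (delBox β μ) (proj₂ cl)
  psν = pos-addBox a μ ps
  same : ∀ j → part (delBox β (addBox a μ)) j ≡ part (addBox a (delBox β μ)) j
  same j with j ≟ β | j ≟ a
  ... | yes refl | yes refl = ⊥-elim (ne refl)
  ... | yes refl | no nea rewrite part-delBox-eq j (addBox a μ) psν c' | part-addBox-ne a (delBox j μ) j al' nea
                                | part-delBox-eq j μ ps cβ | part-addBox-ne a μ j al nea = refl
  ... | no neb | yes refl rewrite part-delBox-ne β (addBox j μ) j psν c' neb | part-addBox-eq j (delBox β μ) al'
                                | part-addBox-eq j μ al | part-delBox-ne β μ j ps cβ neb = refl
  ... | no neb | no nea rewrite part-delBox-ne β (addBox a μ) j psν c' neb | part-addBox-ne a (delBox β μ) j al' nea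
                                | part-addBox-ne a μ j al nea | part-delBox-ne β μ j ps cβ neb = refl

endsWith : ℕ → List ℕ → Bool
endsWith n [] = false
endsWith n (x ∷ []) = x ≡ᵇ n
endsWith n (x ∷ y ∷ ys) = endsWith n (y ∷ ys)

rowEnding : ℕ → Tableau → ℕ
rowEnding n [] = 0
rowEnding n (r ∷ rs) = if endsWith n r then 0 else suc (rowEnding n rs)

dropLast : List ℕ → List ℕ
dropLast [] = []
dropLast (x ∷ []) = []
dropLast (x ∷ y ∷ ys) = x ∷ dropLast (y ∷ ys)

delEntry : ℕ → Tableau → Tableau
delEntry zero [] = []
delEntry zero ([] ∷ rs) = rs
delEntry zero ((x ∷ []) ∷ rs) = rs
delEntry zero ((x ∷ y ∷ ys) ∷ rs) = dropLast (x ∷ y ∷ ys) ∷ rs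
delEntry (suc k) [] = []
delEntry (suc k) (r ∷ rs) = r ∷ delEntry k rs

firstRow : Tableau → List ℕ
firstRow [] = []
firstRow (q ∷ _) = q

length-snoc : ∀ (q : List ℕ) n → length (q ++ [ n ]) ≡ suc (length q)
length-snoc q n = trans (LP.length-++ q) (NP.+-comm (length q) 1)

dropLast-snoc : ∀ (q : List ℕ) n → dropLast (q ++ [ n ]) ≡ q
dropLast-snoc [] n = refl
dropLast-snoc (x ∷ []) n = refl
dropLast-snoc (x ∷ y ∷ q) n = cong (x ∷_) (dropLast-snoc (y ∷ q) n)

length-dropLast : ∀ x y ys → length (dropLast (x ∷ y ∷ ys)) ≡ suc (length ys)
length-dropLast x y [] = refl
length-dropLast x y (z ∷ ys) = cong suc (length-dropLast y z ys)

endsWith-snoc : ∀ n (q : List ℕ) x → endsWith n (q ++ [ x ]) ≡ (x ≡ᵇ n)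
endsWith-snoc n [] x = refl
endsWith-snoc n (y ∷ []) x = refl
endsWith-snoc n (y ∷ z ∷ q) x = endsWith-snoc n (z ∷ q) x

endsWith⇒snoc : ∀ n (q : List ℕ) → endsWith n q ≡ true → q ≡ dropLast q ++ [ n ]
endsWith⇒snoc n (x ∷ []) e = cong [_] (NP.≡ᵇ⇒≡ x n (subst T (sym e) tt))
endsWith⇒snoc n (x ∷ y ∷ q) e = cong (x ∷_) (endsWith⇒snoc n (y ∷ q) e)

endsWith-small : ∀ n (q : List ℕ) → All (_< n) q → endsWith n q ≡ false
endsWith-small n [] _ = refl
endsWith-small n (x ∷ []) (p ∷ []) = ≡ᵇ-false (λ e → NP.<-irrefl e p)
endsWith-small n (x ∷ y ∷ q) (_ ∷ ps) = endsWith-small n (y ∷ q) ps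

endsWith-max : ∀ n (q : List ℕ) → Linked _<_ q → All (_≤ n) q → n ∈ q → endsWith n q ≡ true
endsWith-max n (x ∷ []) _ _ (here refl) = ≡ᵇ-true {x} refl
endsWith-max n (x ∷ y ∷ q) (lt ∷ l) (_ ∷ py ∷ _) (here refl) = ⊥-elim (NP.<-irrefl refl (NP.<-≤-trans lt py))
endsWith-max n (x ∷ y ∷ q) (lt ∷ l) (_ ∷ ps) (there m) = endsWith-max n (y ∷ q) l ps m

increasing-unsnoc : ∀ (q : List ℕ) n → Linked _<_ (q ++ [ n ]) → Linked _<_ q
increasing-unsnoc [] n _ = []
increasing-unsnoc (x ∷ []) n _ = [-]
increasing-unsnoc (x ∷ y ∷ q) n (lt ∷ l) = lt ∷ increasing-unsnoc (y ∷ q) n l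

increasing-snoc : ∀ (q : List ℕ) n → Linked _<_ q → All (_< n) q → Linked _<_ (q ++ [ n ])
increasing-snoc [] n _ _ = [-]
increasing-snoc (x ∷ []) n _ (p ∷ _) = p ∷ [-]
increasing-snoc (x ∷ y ∷ q) n (lt ∷ l) (_ ∷ ps) = lt ∷ increasing-snoc (y ∷ q) n l ps

dropLast-all : ∀ {P : ℕ → Set} (q : List ℕ) → All P q → All P (dropLast q)
dropLast-all [] _ = []
dropLast-all (x ∷ []) _ = []
dropLast-all (x ∷ y ∷ q) (p ∷ ps) = p ∷ dropLast-all (y ∷ q) ps

colStrict-dropLastBelow : ∀ p (q : List ℕ) x → ColStrict p (q ++ [ x ]) → ColStrict p q
colStrict-dropLastBelow p [] x _ = []
colStrict-dropLastBelow (a ∷ p) (y ∷ q) x (lt ∷ c) = lt ∷ colStrict-dropLastBelow p q x c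

colStrict-extendAbove : ∀ p q (z : List ℕ) → ColStrict p q → ColStrict (p ++ z) q
colStrict-extendAbove p [] z _ = []
colStrict-extendAbove (a ∷ p) (y ∷ q) z (lt ∷ c) = lt ∷ colStrict-extendAbove p q z c

colStrict-snocBelow : ∀ p (q : List ℕ) x → ColStrict p q → length q < length p → All (_< x) p →
  ColStrict p (q ++ [ x ])
colStrict-snocBelow (a ∷ p) [] x _ _ (pa ∷ _) = pa ∷ []
colStrict-snocBelow (a ∷ p) (y ∷ q) x (lt ∷ c) (s≤s l) (_ ∷ ps) = lt ∷ colStrict-snocBelow p q x c l ps

colStrict-belowMax : ∀ (p : List ℕ) n q → ColStrict (p ++ [ n ]) q → All (_≤ n) q → length q ≤ length p
colStrict-belowMax [] n [] _ _ = z≤n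
colStrict-belowMax [] n (y ∷ q) (lt ∷ _) (py ∷ _) = ⊥-elim (NP.<-irrefl refl (NP.<-≤-trans lt py))
colStrict-belowMax (a ∷ p) n [] _ _ = z≤n
colStrict-belowMax (a ∷ p) n (y ∷ q) (lt ∷ c) (_ ∷ ps) = s≤s (colStrict-belowMax p n q c ps)

colStrict-shortenAbove : ∀ (p z q : List ℕ) → ColStrict (p ++ z) q → length q ≤ length p → ColStrict p q
colStrict-shortenAbove p z [] _ _ = []
colStrict-shortenAbove (a ∷ p) z (y ∷ q) (lt ∷ c) (s≤s l) = lt ∷ colStrict-shortenAbove p z q c l

cols-cons : ∀ p t → ColStrict p (firstRow t) → Linked ColStrict t → Linked ColStrict (p ∷ t)
cols-cons p [] _ _ = [-]
cols-cons p (q ∷ t) c l = c ∷ l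

cols-head : ∀ p t → Linked ColStrict (p ∷ t) → ColStrict p (firstRow t)
cols-head p [] _ = []
cols-head p (q ∷ t) (c ∷ _) = c

part-firstRow : ∀ t → part (map length t) 0 ≡ length (firstRow t)
part-firstRow [] = refl
part-firstRow (q ∷ t) = refl

firstRow-bound : ∀ {P : ℕ → Set} t → All (All P) t → All P (firstRow t)
firstRow-bound [] _ = []
firstRow-bound (q ∷ t) (b ∷ _) = b

shape-addEntry : ∀ k n t → map length (addEntry k n t) ≡ addBox k (map length t)
shape-addEntry zero n [] = refl
shape-addEntry zero n (q ∷ t) = cong (_∷ map length t) (length-snoc q n)
shape-addEntry (suc k) n [] = refl
shape-addEntry (suc k) n (q ∷ t) = cong (length q ∷_) (shape-addEntry k n t)

shape-delEntry : ∀ k t → map length (delEntry k t) ≡ delBox k (map length t)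
shape-delEntry zero [] = refl
shape-delEntry zero ([] ∷ t) = refl
shape-delEntry zero ((x ∷ []) ∷ t) = refl
shape-delEntry zero ((x ∷ y ∷ ys) ∷ t) = cong (_∷ map length t) (length-dropLast x y ys)
shape-delEntry (suc k) [] = refl
shape-delEntry (suc k) (q ∷ t) = cong (length q ∷_) (shape-delEntry k t)

entries-addEntry : ∀ k n t → concat (addEntry k n t) ↭ n ∷ concat t
entries-addEntry zero n [] = ↭-refl
entries-addEntry zero n (q ∷ t) =
  subst (_↭ n ∷ concat (q ∷ t)) (sym (LP.++-assoc q [ n ] (concat t))) (Perm.shift n q (concat t))
entries-addEntry (suc k) n [] = ↭-refl
entries-addEntry (suc k) n (q ∷ t) = ↭-trans (Perm.++⁺ˡ q (entries-addEntry k n t)) (Perm.shift n q (concat t))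

rows-delEntry : ∀ n r s → r ≤ length s → All (Linked _<_) (addEntry r n s) → All (Linked _<_) s
rows-delEntry n zero [] _ _ = []
rows-delEntry n zero (q ∷ s) _ (l ∷ ls) = increasing-unsnoc q n l ∷ ls
rows-delEntry n (suc r) (q ∷ s) (s≤s p) (l ∷ ls) = l ∷ rows-delEntry n r s p ls

rows-addEntry : ∀ n r s → All (Linked _<_) s → All (All (_< n)) s → All (Linked _<_) (addEntry r n s)
rows-addEntry n zero [] _ _ = [-] ∷ []
rows-addEntry n zero (q ∷ s) (l ∷ ls) (b ∷ _) = increasing-snoc q n l b ∷ ls
rows-addEntry n (suc r) [] _ _ = [-] ∷ []
rows-addEntry n (suc r) (q ∷ s) (l ∷ ls) (_ ∷ bs) = l ∷ rows-addEntry n r s ls bs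

colStrict-delEntry : ∀ n r s → r ≤ length s → All (All (_≤ n)) s → Linked ColStrict (addEntry r n s) →
  Linked ColStrict s × Corner r (map length (addEntry r n s))
    × (∀ p → ColStrict p (firstRow (addEntry r n s)) → ColStrict p (firstRow s))
colStrict-delEntry n zero [] _ _ _ = [] , s≤s z≤n , (λ p _ → [])
colStrict-delEntry n zero (q ∷ s) _ (bq ∷ bs) l =
  cols-cons q s (colStrict-shortenAbove q [ n ] (firstRow s) below shorter) (Linked.tail l) ,
  corner , (λ p c → colStrict-dropLastBelow p q n c)
  where
  below = cols-head (q ++ [ n ]) s l
  shorter = colStrict-belowMax q n (firstRow s) below (firstRow-bound s bs)
  corner : part (map length s) 0 < length (q ++ [ n ])
  corner rewrite part-firstRow s | length-snoc q n = s≤s shorter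
colStrict-delEntry n (suc r) (q ∷ s) (s≤s p) (bq ∷ bs) l with colStrict-delEntry n r s p bs (Linked.tail l)
... | ls , c , below = cols-cons q s (below q (cols-head q _ l)) ls , c , (λ p c → c)

colStrict-addEntry : ∀ n r s → r ≤ length s → All (All (_< n)) s → Linked ColStrict s →
  Addable r (map length s) → Linked ColStrict (addEntry r n s)
colStrict-addEntry n zero [] _ _ _ _ = [-]
colStrict-addEntry n zero (q ∷ s) _ _ l _ =
  cols-cons _ s (colStrict-extendAbove q (firstRow s) [ n ] (cols-head q s l)) (Linked.tail l)
colStrict-addEntry n (suc zero) (q ∷ []) _ (bq ∷ _) _ ad = colStrict-snocBelow q [] n [] ad bq ∷ [-]
colStrict-addEntry n (suc zero) (q ∷ q' ∷ s) (s≤s p) (bq ∷ bs) l ad =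
  colStrict-snocBelow q q' n (cols-head q _ l) ad bq ∷ colStrict-addEntry n zero (q' ∷ s) p bs (Linked.tail l) tt
colStrict-addEntry n (suc (suc r)) (q ∷ q' ∷ s) (s≤s p) (bq ∷ bs) l ad =
  cols-cons q (addEntry (suc r) n (q' ∷ s)) (cols-head q (q' ∷ s) l)
    (colStrict-addEntry n (suc r) (q' ∷ s) p bs (Linked.tail l) ad)

rowEnding-addEntry : ∀ n r s → All (All (_< n)) s → r ≤ length s → rowEnding n (addEntry r n s) ≡ r
rowEnding-addEntry n zero [] _ _ rewrite ≡ᵇ-true {n} refl = refl
rowEnding-addEntry n zero (q ∷ s) _ _ rewrite endsWith-snoc n q n | ≡ᵇ-true {n} refl = refl
rowEnding-addEntry n (suc r) (q ∷ s) (b ∷ bs) (s≤s p) rewrite endsWith-small n q b = cong suc (rowEnding-addEntry n r s bs p)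

delEntry-addEntry : ∀ n r s → Pos (map length s) → r ≤ length s → delEntry r (addEntry r n s) ≡ s
delEntry-addEntry n zero [] _ _ = refl
delEntry-addEntry n zero ([] ∷ s) (() ∷ _) _
delEntry-addEntry n zero ((x ∷ []) ∷ s) _ _ = refl
delEntry-addEntry n zero ((x ∷ y ∷ q) ∷ s) _ _ = cong (λ z → (x ∷ z) ∷ s) (dropLast-snoc (y ∷ q) n)
delEntry-addEntry n (suc r) (q ∷ s) (_ ∷ ps) (s≤s p) = cong (q ∷_) (delEntry-addEntry n r s ps p)

rowEnding-< : ∀ n t → Any (n ∈_) t → All (Linked _<_) t → All (All (_≤ n)) t → rowEnding n t < length t
rowEnding-< n (q ∷ t) a (l ∷ ls) (b ∷ bs) with endsWith n q in eq
... | true = s≤s z≤n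
rowEnding-< n (q ∷ t) (here m) (l ∷ ls) (b ∷ bs) | false with trans (sym eq) (endsWith-max n q l b m)
... | ()
rowEnding-< n (q ∷ t) (there a) (l ∷ ls) (b ∷ bs) | false = s≤s (rowEnding-< n t a ls bs)

addEntry-delEntry-first : ∀ n q t → endsWith n q ≡ true → Pos (map length t) → Linked ColStrict (q ∷ t) →
  All (All (_≤ n)) t → addEntry 0 n (delEntry 0 (q ∷ t)) ≡ q ∷ t
addEntry-delEntry-first n (x ∷ []) [] e _ _ _ with endsWith⇒snoc n (x ∷ []) e
... | refl = refl
addEntry-delEntry-first n (x ∷ []) ([] ∷ t) e (() ∷ _) _ _
addEntry-delEntry-first n (x ∷ []) ((y ∷ q') ∷ t) e _ ((lt ∷ _) ∷ _) ((py ∷ _) ∷ _) with endsWith⇒snoc n (x ∷ []) e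
... | refl = ⊥-elim (NP.<-irrefl refl (NP.<-≤-trans lt py))
addEntry-delEntry-first n (x ∷ y ∷ ys) t e _ _ _ = cong (_∷ t) (sym (endsWith⇒snoc n (x ∷ y ∷ ys) e))

addEntry-delEntry : ∀ n t → rowEnding n t < length t → Pos (map length t) → Linked ColStrict t →
  All (All (_≤ n)) t → addEntry (rowEnding n t) n (delEntry (rowEnding n t) t) ≡ t
addEntry-delEntry n (q ∷ t) p (pq ∷ ps) l (bq ∷ bs) with endsWith n q in eq
... | true = addEntry-delEntry-first n q t eq ps l bs
... | false = cong (q ∷_) (addEntry-delEntry n t (NP.≤-pred p) ps (Linked.tail l) bs)

SYT-entries : ∀ ν t → IsSYT ν t → All (All (_≤ sum ν)) t
SYT-entries ν t (_ , _ , _ , p) =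
  AllP.concat⁻ (Perm.All-resp-↭ (↭-sym p) (All.tabulate ∈-oneTo⁻))

SYT-max : ∀ ν t m → IsSYT ν t → sum ν ≡ suc m → Any (suc m ∈_) t
SYT-max ν t m (_ , _ , _ , p) e =
  ∈-concat⁻ t (Perm.∈-resp-↭ (↭-sym p) (subst (λ k → suc m ∈ oneTo k) (sym e) (∈-map⁺ suc (∈-upTo⁺ (NP.n<1+n m)))))

SYT-pos : ∀ ν t → IsSYT ν t → Pos ν → Pos (map length t)
SYT-pos ν t (e , _) p = subst Pos (sym e) p

SYT-length : ∀ ν t → IsSYT ν t → length t ≡ length ν
SYT-length ν t (e , _) = trans (sym (LP.length-map length t)) (cong length e)

length-delEntry : ∀ r t → r < length t → r ≤ length (delEntry r t)
length-delEntry zero t _ = z≤n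
length-delEntry (suc r) (q ∷ t) (s≤s p) = s≤s (length-delEntry r t p)

delEntry-bound : ∀ {P : ℕ → Set} r t → All (All P) t → All (All P) (delEntry r t)
delEntry-bound zero [] _ = []
delEntry-bound zero ([] ∷ t) (_ ∷ bs) = bs
delEntry-bound zero ((x ∷ []) ∷ t) (_ ∷ bs) = bs
delEntry-bound zero ((x ∷ y ∷ q) ∷ t) (b ∷ bs) = dropLast-all (x ∷ y ∷ q) b ∷ bs
delEntry-bound (suc r) [] _ = []
delEntry-bound (suc r) (q ∷ t) (b ∷ bs) = b ∷ delEntry-bound r t bs

sum-delBox-corner : ∀ r ν m → sum ν ≡ suc m → Corner r ν → sum (delBox r ν) ≡ m
sum-delBox-corner r ν m e c = NP.suc-injective (trans (sum-delBox r ν (NP.≤-<-trans z≤n c)) e)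

record MaxRemoved (ν : List ℕ) (t : Tableau) (m : ℕ) : Set where
  field
    corner   : Corner (rowEnding (suc m) t) ν
    restored : t ≡ addEntry (rowEnding (suc m) t) (suc m) (delEntry (rowEnding (suc m) t) t)
    smaller  : IsSYT (delBox (rowEnding (suc m) t) ν) (delEntry (rowEnding (suc m) t) t)

removeMax : ∀ ν t m → IsPartition ν → IsSYT ν t → sum ν ≡ suc m → MaxRemoved ν t m
removeMax ν t m P S@(sh , rows , cols , perm) e = record { corner = cor ; restored = teq ; smaller = syt }
  where
  n = suc m
  r = rowEnding n t
  s = delEntry r t
  bt : All (All (_≤ n)) t
  bt = subst (λ k → All (All (_≤ k)) t) e (SYT-entries ν t S)
  r<t : r < length t
  r<t = rowEnding-< n t (SYT-max ν t m S e) rows bt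
  teq = sym (addEntry-delEntry n t r<t (SYT-pos ν t S (proj₁ P)) cols bt)
  r≤s : r ≤ length s
  r≤s = length-delEntry r t r<t
  parts = colStrict-delEntry n r s r≤s (delEntry-bound r t bt) (subst (Linked ColStrict) teq cols)
  cor : Corner r ν
  cor = subst (Corner r) (trans (cong (map length) (sym teq)) sh) (proj₁ (proj₂ parts))
  perm' : concat s ↭ oneTo m
  perm' = Perm.drop-∷ (↭-trans (↭-sym (entries-addEntry r n s))
            (↭-trans (subst (λ z → concat z ↭ oneTo (sum ν)) teq perm)
              (subst (λ k → oneTo k ↭ n ∷ oneTo m) (sym e) (oneTo-perm m))))
  syt : IsSYT (delBox r ν) s
  syt = trans (shape-delEntry r t) (cong (delBox r) sh) ,
        rows-delEntry n r s r≤s (subst (All (Linked _<_)) teq rows) ,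
        proj₁ parts ,
        subst (λ k → concat s ↭ oneTo k) (sym (sum-delBox-corner r ν m e cor)) perm'

record MaxAdded (ν : List ℕ) (s : Tableau) (m r : ℕ) : Set where
  field
    larger  : IsSYT ν (addEntry r (suc m) s)
    row     : rowEnding (suc m) (addEntry r (suc m) s) ≡ r
    deleted : delEntry r (addEntry r (suc m) s) ≡ s

addMax : ∀ ν s m r → IsPartition ν → sum ν ≡ suc m → Corner r ν → IsSYT (delBox r ν) s → MaxAdded ν s m r
addMax ν s m r P e c S@(sh , rows , cols , perm) =
  record { larger = syt ; row = rowEnding-addEntry n r s b< r≤ ; deleted = delEntry-addEntry n r s ps r≤ }
  where
  n = suc m
  sumd = sum-delBox-corner r ν m e c
  b< : All (All (_< n)) s
  b< = All.map (All.map s≤s) (subst (λ k → All (All (_≤ k)) s) sumd (SYT-entries _ s S))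
  ps : Pos (map length s)
  ps = SYT-pos _ s S (pos-delBox r ν (proj₁ P))
  r≤ : r ≤ length s
  r≤ = subst (r ≤_) (sym (SYT-length _ s S)) (length-delBox r ν (proj₁ P) c)
  syt : IsSYT ν (addEntry r n s)
  syt = trans (shape-addEntry r n s) (trans (cong (addBox r) sh) (addBox-delBox r ν P c)) ,
        rows-addEntry n r s rows b< ,
        colStrict-addEntry n r s r≤ b< cols (subst (Addable r) (sym sh) (addable-delBox r ν P c)) ,
        ↭-trans (entries-addEntry r n s) (↭-trans (prep n (subst (λ k → concat s ↭ oneTo k) sumd perm))
          (↭-sym (subst (λ k → oneTo k ↭ n ∷ oneTo m) (sym e) (oneTo-perm m))))

Enum : (Tableau → Set) → List Tableau → Set
Enum P xs = Unique xs × (∀ t → (t ∈ xs) ⇔ P t)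

enum-to : ∀ {P xs} → Enum P xs → ∀ {t} → t ∈ xs → P t
enum-to (_ , m) {t} = Equivalence.to (m t)

enum-from : ∀ {P xs} → Enum P xs → ∀ {t} → P t → t ∈ xs
enum-from (_ , m) {t} = Equivalence.from (m t)

enum-empty : ∀ {P xs} → Enum P xs → (∀ t → ¬ P t) → xs ≡ []
enum-empty {xs = []} E h = refl
enum-empty {xs = x ∷ xs} E h = ⊥-elim (h x (enum-to E (here refl)))

enum-single : ∀ {P xs} x → Enum P xs → (∀ t → P t → t ≡ x) → P x → xs ≡ [ x ]
enum-single {xs = []} x E h px with enum-from E px
... | ()
enum-single {xs = y ∷ ys} x E@(py ∷ _ , _) h px with h y (enum-to E (here refl))
... | refl = cong (y ∷_) (noOther ys (λ m → h _ (enum-to E (there m))) py)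
  where
  noOther : ∀ zs → (∀ {z} → z ∈ zs → z ≡ y) → All (λ z → ¬ y ≡ z) zs → zs ≡ []
  noOther [] _ _ = refl
  noOther (z ∷ zs) hz (q ∷ _) = ⊥-elim (q (sym (hz (here refl))))

enum-equiv : ∀ {P Q xs} → Enum P xs → (∀ t → P t → Q t) → (∀ t → Q t → P t) → Enum Q xs
enum-equiv (u , m) f g = u , (λ t → mk⇔ (f t ∘ Equivalence.to (m t)) (Equivalence.from (m t) ∘ g t))

enum-length : ∀ {P xs ys} → Enum P xs → Enum P ys → length xs ≡ length ys
enum-length (ux , mx) (uy , my) = Perm.↭-length (∼bag⇒↭ (unique∧set⇒bag ux uy (λ {t} →
  mk⇔ (Equivalence.from (my t) ∘ Equivalence.to (mx t)) (Equivalence.from (mx t) ∘ Equivalence.to (my t)))))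

map-unique-on : {A B : Set} (f : A → B) (xs : List A) →
  (∀ {x y} → x ∈ xs → y ∈ xs → f x ≡ f y → x ≡ y) → Unique xs → Unique (map f xs)
map-unique-on f [] inj u = []
map-unique-on f (x ∷ xs) inj (px ∷ u) =
  AllP.map⁺ (All.tabulate (λ ym e → All.lookup px ym (inj (here refl) (there ym) e))) ∷
  map-unique-on f xs (λ a b → inj (there a) (there b)) u

module Decompose (ν : List ℕ) (m : ℕ) (us : List Tableau) (P : IsPartition ν) (e : sum ν ≡ suc m)
                 (E : Enum (IsSYT ν) us) where

  n = suc m

  inRow : (r : ℕ) (t : Tableau) → Dec (r ≡ rowEnding n t)
  inRow r t = r ≟ rowEnding n t

  sub : ℕ → List Tableau
  sub r = map (delEntry r) (filter (inRow r) us)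

  removed : ∀ {t} → t ∈ us → MaxRemoved ν t m
  removed mt = removeMax ν _ m P (enum-to E mt) e

  restore : ∀ r {t} → t ∈ filter (inRow r) us → t ≡ addEntry r n (delEntry r t)
  restore r mt with ∈-filter⁻ (inRow r) mt
  ... | mu , refl = MaxRemoved.restored (removed mu)

  Σ-byRow : ∀ (F : Tableau → ℤ) L → length ν ≤ L → Σl us F ≡ Σr L (λ r → Σl (sub r) (λ s → F (addEntry r n s)))
  Σ-byRow F L p = begin
      Σl us F
    ≡⟨ Σl-cong us (λ t mt → sym (Σr-δ L (rowEnding n t) (λ _ → F t)
         (NP.<-≤-trans (Corner⇒< _ ν (MaxRemoved.corner (removed mt))) p))) ⟩
      Σl us (λ t → Σr L (λ r → if r ≡ᵇ rowEnding n t then F t else + 0))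
    ≡⟨ Σl-Σr us L (λ t r → if r ≡ᵇ rowEnding n t then F t else + 0) ⟩
      Σr L (λ r → Σl us (λ t → if r ≡ᵇ rowEnding n t then F t else + 0))
    ≡⟨ Σr-ext L (λ r _ → sym (trans (Σl-filter (inRow r) us F)
         (Σl-ext us (λ t → cong (λ b → if b then F t else + 0) (≟-≡ᵇ r (rowEnding n t)))))) ⟩
      Σr L (λ r → Σl (filter (inRow r) us) F)
    ≡⟨ Σr-ext L (λ r _ → Σl-cong (filter (inRow r) us) (λ t mt → cong F (restore r mt))) ⟩
      Σr L (λ r → Σl (filter (inRow r) us) (λ t → F (addEntry r n (delEntry r t))))
    ≡⟨ Σr-ext L (λ r _ → sym (Σl-map (delEntry r) (filter (inRow r) us) (λ s → F (addEntry r n s)))) ⟩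
      Σr L (λ r → Σl (sub r) (λ s → F (addEntry r n s)))
    ∎
    where open ≡-Reasoning

  sub-enum-corner : ∀ r → Enum (λ s → IsSYT (delBox r ν) s × Corner r ν) (sub r)
  sub-enum-corner r = map-unique-on (delEntry r) (filter (inRow r) us) injective (UniqueP.filter⁺ (inRow r) (proj₁ E)) ,
                (λ s → mk⇔ (to s) (from s))
    where
    injective : ∀ {x y} → x ∈ filter (inRow r) us → y ∈ filter (inRow r) us → delEntry r x ≡ delEntry r y → x ≡ y
    injective mx my eq = trans (restore r mx) (trans (cong (addEntry r n) eq) (sym (restore r my)))
    to : ∀ s → s ∈ sub r → IsSYT (delBox r ν) s × Corner r ν
    to s ms with ∈-map⁻ (delEntry r) ms
    ... | t , mt , refl with ∈-filter⁻ (inRow r) mt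
    ... | mu , refl = MaxRemoved.smaller (removed mu) , MaxRemoved.corner (removed mu)
    from : ∀ s → IsSYT (delBox r ν) s × Corner r ν → s ∈ sub r
    from s (S , c) = subst (_∈ sub r) (MaxAdded.deleted A)
      (∈-map⁺ (delEntry r) (∈-filter⁺ (inRow r) (enum-from E (MaxAdded.larger A)) (sym (MaxAdded.row A))))
      where
      A = addMax ν s m r P e c S

  sub-empty : ∀ r → ¬ Corner r ν → sub r ≡ []
  sub-empty r nc = enum-empty (sub-enum-corner r) (λ t x → nc (proj₂ x))

  sub-enum : ∀ r → Corner r ν → Enum (IsSYT (delBox r ν)) (sub r)
  sub-enum r c = enum-equiv (sub-enum-corner r) (λ t → proj₁) (λ t x → x , c)

  count-byRow : ∀ L → length ν ≤ L → + length us ≡ Σr L (λ r → + length (sub r))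
  count-byRow L p = trans (sym (Σl-1 us)) (trans (Σ-byRow (λ _ → + 1) L p) (Σr-ext L (λ r _ → Σl-1 (sub r))))

rowCount : List Tableau → ℕ → ℕ → ℤ
rowCount ts n a = Σl ts (λ t → Σl (oneTo (suc n)) (λ i → δ (endRow t i) a))

record RowCount (μ : List ℕ) (ts : List Tableau) (n a : ℕ) : Set where
  field
    addable     : Addable a μ → ∀ us → Enum (IsSYT (addBox a μ)) us → rowCount ts n a ≡ + length us
    not-addable : ¬ Addable a μ → rowCount ts n a ≡ + 0

RowCountTheorem : ℕ → Set
RowCountTheorem n = ∀ μ → IsPartition μ → sum μ ≡ n → ∀ ts → Enum (IsSYT μ) ts → ∀ a → RowCount μ ts n a

empty-partition : ∀ μ → Pos μ → sum μ ≡ 0 → μ ≡ []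
empty-partition [] _ _ = refl
empty-partition (suc x ∷ μ) (p ∷ _) ()

SYT-empty : ∀ t → IsSYT [] t → t ≡ []
SYT-empty [] _ = refl
SYT-empty (q ∷ t) (() , _)

SYT-empty-ok : IsSYT [] []
SYT-empty-ok = refl , [] , [] , ↭-refl

enum-SYT-empty : ∀ μ → IsPartition μ → sum μ ≡ 0 → ∀ ts → Enum (IsSYT μ) ts → μ ≡ [] × ts ≡ [ [] ]
enum-SYT-empty μ P e ts E with empty-partition μ (proj₁ P) e
... | refl = refl , enum-single [] E SYT-empty SYT-empty-ok

SYT-one : ∀ t → IsSYT [ 1 ] t → t ≡ [ [ 1 ] ]
SYT-one ((x ∷ []) ∷ []) (refl , _ , _ , p) with Perm.↭-singleton-inv p
... | refl = refl

SYT-one-ok : IsSYT [ 1 ] [ [ 1 ] ]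
SYT-one-ok = refl , ([-] ∷ []) , [-] , ↭-refl

δ-raise : ∀ r x a → δ (raise r x) a ≡ (if r ≡ᵇ a then + 0 else δ x a) +ℤ (if suc r ≡ᵇ a then δ x r else + 0)
δ-raise r x a with x ≟ r
δ-raise r x a | yes refl rewrite raise-eq x | ≡ᵇ-true {x} refl with x ≟ a
... | yes refl rewrite ≡ᵇ-true {x} refl | ≡ᵇ-false {suc x} {x} (n≢1+n x ∘ sym) = refl
... | no ne rewrite ≡ᵇ-false ne with suc x ≡ᵇ a
...   | true = refl
...   | false = refl
δ-raise r x a | no ne rewrite raise-neq r x ne | ≡ᵇ-false ne with r ≟ a
... | yes refl rewrite ≡ᵇ-true {r} refl | ≡ᵇ-false {suc r} {r} (n≢1+n r ∘ sym) | ≡ᵇ-false ne = refl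
... | no ne2 rewrite ≡ᵇ-false ne2 with suc r ≡ᵇ a
...   | true = sym (ZP.+-identityʳ _)
...   | false = sym (ZP.+-identityʳ _)

cornerAbove : List ℕ → ℕ → ℤ → ℕ → ℤ
cornerAbove μ a k r = if suc r ≡ᵇ a then (if ⌊ Corner? r μ ⌋ then k else + 0) else + 0

cornerAbove-addable : ∀ μ a k L → length μ < L → Addable a μ → Σr L (cornerAbove μ a k) +ℤ δ 0 a * k ≡ k
cornerAbove-addable μ zero k L p ad rewrite Σr-0 L = trans (ZP.+-identityˡ _) (ZP.*-identityˡ k)
cornerAbove-addable μ (suc a) k L p ad
  rewrite Σr-δ L a (λ r → if ⌊ Corner? r μ ⌋ then k else + 0) (NP.<-trans (Corner⇒< a μ ad) p) with Corner? a μ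
... | yes _ = ZP.+-identityʳ k
... | no nc = ⊥-elim (nc ad)

cornerAbove-not-addable : ∀ μ a k L → ¬ Addable a μ → Σr L (cornerAbove μ a k) +ℤ δ 0 a * k ≡ + 0
cornerAbove-not-addable μ zero k L nad = ⊥-elim (nad tt)
cornerAbove-not-addable μ (suc a) k L nad = trans (ZP.+-identityʳ _) (trans (Σr-ext L (λ r _ → vanish r)) (Σr-0 L))
  where
  vanish : ∀ r → cornerAbove μ (suc a) k r ≡ + 0
  vanish r with r ≟ a
  ... | no ne rewrite ≡ᵇ-false ne = refl
  ... | yes refl rewrite ≡ᵇ-true {r} refl with Corner? r μ
  ...   | yes c = ⊥-elim (nad c)
  ...   | no _ = refl

Σl-guards : {A : Set} (xs : List A) (b b' : Bool) (f g : A → ℤ) →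
  Σl xs (λ x → (if b then + 0 else f x) +ℤ (if b' then g x else + 0))
  ≡ (if b then + 0 else Σl xs f) +ℤ (if b' then Σl xs g else + 0)
Σl-guards xs b b' f g = trans (Σl-+ xs _ _) (cong₂ _+ℤ_ (Σl-unless xs b f) (Σl-when xs b' g))

Σ-δ-raise : {A : Set} (xs : List A) (g : A → ℕ) (r a : ℕ) →
  Σl xs (λ x → δ (raise r (g x)) a)
  ≡ (if r ≡ᵇ a then + 0 else Σl xs (λ x → δ (g x) a)) +ℤ (if suc r ≡ᵇ a then Σl xs (λ x → δ (g x) r) else + 0)
Σ-δ-raise xs g r a = trans (Σl-ext xs (λ x → δ-raise r (g x) a))
  (Σl-guards xs (r ≡ᵇ a) (suc r ≡ᵇ a) (λ x → δ (g x) a) (λ x → δ (g x) r))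

module Step (m : ℕ) (IH : RowCountTheorem m) (μ : List ℕ) (P : IsPartition μ) (e : sum μ ≡ suc m)
            (ts : List Tableau) (E : Enum (IsSYT μ) ts) where
  open Decompose μ m ts P e E public

  L = suc (length μ)
  K = + length ts

  length≤L : length μ ≤ L
  length≤L = NP.n≤1+n _

  IH-corner : ∀ r → Corner r μ → ∀ b → RowCount (delBox r μ) (sub r) m b
  IH-corner r c = IH (delBox r μ) (partition-delBox r μ P c) (sum-delBox-corner r μ m e c) (sub r) (sub-enum r c)

  sub-bound : ∀ r s → s ∈ sub r → All (All (_≤ m)) s
  sub-bound r s ms with enum-to (sub-enum-corner r) ms
  ... | S , c = subst (λ k → All (All (_≤ k)) s) (sum-delBox-corner r μ m e c) (SYT-entries _ s S)

  sub-row : ∀ r s → s ∈ sub r → r ≤ length s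
  sub-row r s ms with enum-to (sub-enum-corner r) ms
  ... | S , c = subst (r ≤_) (sym (SYT-length _ s S)) (length-delBox r μ (proj₁ P) c)

  rowCount-corner : ∀ r → Corner r μ → rowCount (sub r) m r ≡ K
  rowCount-corner r c = RowCount.addable (IH-corner r c r) (addable-delBox r μ P c) ts
    (subst (λ α → Enum (IsSYT α) ts) (sym (addBox-delBox r μ P c)) E)

  Σ-row : ∀ (g : ℕ → ℤ) r → Σl (sub r) (λ s → Σl (oneTo (suc (suc m))) (λ i → g (endRow (addEntry r (suc m) s) i)))
    ≡ Σl (sub r) (λ s → Σl (oneTo (suc m)) (λ i → g (raise r (endRow s i)))) +ℤ g 0 * + length (sub r)
  Σ-row g r = trans (Σl-cong (sub r) (λ s ms → Σ-endRow-addEntry g m r s (sub-bound r s ms) (sub-row r s ms)))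
                    (Σl-+const (sub r) _ (g 0))

module RowCountStep (m : ℕ) (IH : RowCountTheorem m) (μ : List ℕ) (P : IsPartition μ) (e : sum μ ≡ suc m)
                    (ts : List Tableau) (E : Enum (IsSYT μ) ts) (a : ℕ) where
  open Step m IH μ P e ts E

  skipRow : ℕ → ℤ
  skipRow r = if r ≡ᵇ a then + 0 else rowCount (sub r) m a

  fromAbove : ℕ → ℤ
  fromAbove r = if suc r ≡ᵇ a then rowCount (sub r) m r else + 0

  fromAbove-corner : ∀ r → fromAbove r ≡ cornerAbove μ a K r
  fromAbove-corner r = cong (λ z → if suc r ≡ᵇ a then z else + 0) count
    where
    count : rowCount (sub r) m r ≡ (if ⌊ Corner? r μ ⌋ then K else + 0)
    count with Corner? r μ
    ... | yes c = rowCount-corner r c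
    ... | no nc rewrite sub-empty r nc = refl

  Σ-row-count : ∀ r → Σl (sub r) (λ s → Σl (oneTo (suc (suc m))) (λ i → δ (endRow (addEntry r (suc m) s) i) a))
    ≡ (skipRow r +ℤ fromAbove r) +ℤ δ 0 a * + length (sub r)
  Σ-row-count r = trans (Σ-row (λ x → δ x a) r) (cong (_+ℤ δ 0 a * + length (sub r))
    (trans (Σl-ext (sub r) (λ s → Σ-δ-raise (oneTo (suc m)) (endRow s) r a))
      (Σl-guards (sub r) (r ≡ᵇ a) (suc r ≡ᵇ a) (λ s → Σl (oneTo (suc m)) (λ i → δ (endRow s i) a))
                                              (λ s → Σl (oneTo (suc m)) (λ i → δ (endRow s i) r)))))

  rowCount-decomp : rowCount ts (suc m) a ≡ Σr L skipRow +ℤ (Σr L (cornerAbove μ a K) +ℤ δ 0 a * K)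
  rowCount-decomp = begin
      rowCount ts (suc m) a
    ≡⟨ Σ-byRow _ L length≤L ⟩
      Σr L (λ r → Σl (sub r) (λ s → Σl (oneTo (suc (suc m))) (λ i → δ (endRow (addEntry r (suc m) s) i) a)))
    ≡⟨ Σr-ext L (λ r _ → Σ-row-count r) ⟩
      Σr L (λ r → (skipRow r +ℤ fromAbove r) +ℤ δ 0 a * + length (sub r))
    ≡⟨ Σr-+ L _ _ ⟩
      Σr L (λ r → skipRow r +ℤ fromAbove r) +ℤ Σr L (λ r → δ 0 a * + length (sub r))
    ≡⟨ cong₂ _+ℤ_ (trans (Σr-+ L skipRow fromAbove) (cong (Σr L skipRow +ℤ_) (Σr-ext L (λ r _ → fromAbove-corner r))))
                  (trans (Σr-*ˡ L (δ 0 a) _) (cong (δ 0 a *_) (sym (count-byRow L length≤L)))) ⟩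
      (Σr L skipRow +ℤ Σr L (cornerAbove μ a K)) +ℤ δ 0 a * K
    ≡⟨ ZP.+-assoc (Σr L skipRow) _ _ ⟩
      Σr L skipRow +ℤ (Σr L (cornerAbove μ a K) +ℤ δ 0 a * K)
    ∎
    where open ≡-Reasoning

  not-addable : ¬ Addable a μ → rowCount ts (suc m) a ≡ + 0
  not-addable nad = trans rowCount-decomp
    (cong₂ _+ℤ_ (trans (Σr-ext L (λ r _ → skip0 r)) (Σr-0 L)) (cornerAbove-not-addable μ a K L nad))
    where
    skip0 : ∀ r → skipRow r ≡ + 0
    skip0 r with r ≟ a
    ... | yes refl rewrite ≡ᵇ-true {r} refl = refl
    ... | no ne rewrite ≡ᵇ-false ne with Corner? r μ
    ...   | yes c = RowCount.not-addable (IH-corner r c a) (nad ∘ addable-delBox⇒addable r a μ (proj₁ P) c ne)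
    ...   | no nc rewrite sub-empty r nc = refl

  -- if a is addable, decompose SYT(ν), ν = μ + □_a, by the row of n + 1 as well
  module Addable (ad : Addable a μ) (us : List Tableau) (EU : Enum (IsSYT (addBox a μ)) us) where
    ν = addBox a μ
    al = Addable⇒≤ a μ ad
    module U = Decompose ν (suc m) us (partition-addBox a μ P ad) (trans (sum-addBox a μ) (cong suc e)) EU

    others : ℕ → ℤ
    others β = if β ≡ᵇ a then + 0 else + length (U.sub β)

    count-split : + length us ≡ + length (U.sub a) +ℤ Σr L others
    count-split = trans (U.count-byRow L (length-addBox a μ)) (Σr-split L a _ (s≤s al))

    -- ν − □_a = μ
    count-a : length ts ≡ length (U.sub a)
    count-a = enum-length E (subst (λ α → Enum (IsSYT α) (U.sub a)) (delBox-addBox a μ P al)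
      (U.sub-enum a (corner-addBox a μ al (partition⇒Decr μ P))))

    -- for β ≠ a, the count in μ − □_β is f^{(μ − □_β) + □_a} = f^{ν − □_β}
    skipRow-others : ∀ β → skipRow β ≡ others β
    skipRow-others β with β ≟ a
    ... | yes refl rewrite ≡ᵇ-true {β} refl = refl
    ... | no ne rewrite ≡ᵇ-false ne with Corner? β ν
    ...   | yes c' = RowCount.addable (IH-corner β cβ a) ad' (U.sub β)
                       (subst (λ α → Enum (IsSYT α) (U.sub β)) (delBox-addBox-comm β a μ P ne ad c') (U.sub-enum β c'))
      where
      cβ = proj₁ (corner-addBox⇒corner β a μ P ne ad c')
      ad' = proj₂ (corner-addBox⇒corner β a μ P ne ad c')
    ...   | no nc' rewrite U.sub-empty β nc' with Corner? β μ
    ...     | yes cβ = RowCount.not-addable (IH-corner β cβ a) (λ ad' → nc' (corner⇒corner-addBox β a μ (proj₁ P) ne cβ ad' al))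
    ...     | no ncβ rewrite sub-empty β ncβ = refl

    addable : rowCount ts (suc m) a ≡ + length us
    addable = begin
        rowCount ts (suc m) a
      ≡⟨ rowCount-decomp ⟩
        Σr L skipRow +ℤ (Σr L (cornerAbove μ a K) +ℤ δ 0 a * K)
      ≡⟨ cong (Σr L skipRow +ℤ_) (cornerAbove-addable μ a K L (NP.n<1+n _) ad) ⟩
        Σr L skipRow +ℤ K
      ≡⟨ cong₂ _+ℤ_ (Σr-ext L (λ β _ → skipRow-others β)) (cong +_ count-a) ⟩
        Σr L others +ℤ + length (U.sub a)
      ≡⟨ ZP.+-comm (Σr L others) _ ⟩
        + length (U.sub a) +ℤ Σr L others
      ≡⟨ sym count-split ⟩
        + length us
      ∎
      where open ≡-Reasoning

  result : RowCount μ ts (suc m) a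
  result = record { addable = Addable.addable ; not-addable = not-addable }

rowCount-theorem : ∀ n → RowCountTheorem n
rowCount-theorem zero μ P e ts E a with enum-SYT-empty μ P e ts E
... | refl , refl = record { addable = base-addable a ; not-addable = base-not-addable a }
  where
  base-addable : ∀ a → Addable a [] → ∀ us → Enum (IsSYT (addBox a [])) us → rowCount [ [] ] 0 a ≡ + length us
  base-addable zero _ us EU rewrite enum-single [ [ 1 ] ] EU SYT-one SYT-one-ok = refl
  base-not-addable : ∀ a → ¬ Addable a [] → rowCount [ [] ] 0 a ≡ + 0
  base-not-addable zero nad = ⊥-elim (nad tt)
  base-not-addable (suc a) nad = refl
rowCount-theorem (suc m) μ P e ts E a = RowCountStep.result m (rowCount-theorem m) μ P e ts E a

moment : (ℤ → ℤ) → List ℕ → List Tableau → ℕ → ℤ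
moment φ μ ts n = Σl ts (λ t → Σl (oneTo (suc n)) (λ i → φ (rowContent μ (endRow t i))))

-- When the end row r is raised to r + 1, the square added to μ − □_r in
-- row r (content r − μ_r + 1) is replaced by the square added to μ in row
-- r + 1; Δ φ μ r is the resulting change of φ.
Δ : (ℤ → ℤ) → List ℕ → ℕ → ℤ
Δ φ μ r = φ (rowContent μ (suc r)) - φ ((+ r - + part μ r) +ℤ + 1)

-- no change at a row that is not a corner: both squares are the same
Δ-not-corner : ∀ φ μ r → Decr μ → ¬ Corner r μ → Δ φ μ r ≡ + 0
Δ-not-corner φ μ r D nc rewrite NP.≤-antisym (D r) (NP.≮⇒≥ nc) =
  trans (cong (λ z → φ z - φ ((+ r - + part μ r) +ℤ + 1)) (shiftOne (+ r) (+ part μ r)))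
        (ZP.+-inverseʳ (φ ((+ r - + part μ r) +ℤ + 1)))
  where
  shiftOne : ∀ (a b : ℤ) → (+ 1 +ℤ a) - b ≡ (a - b) +ℤ + 1
  shiftOne = solve-∀

content-pred : ∀ x k → 0 < k → + x - + N.pred k ≡ (+ x - + k) +ℤ + 1
content-pred x (suc k) _ = moveOne (+ x) (+ k)
  where
  moveOne : ∀ (a b : ℤ) → a - b ≡ (a - (+ 1 +ℤ b)) +ℤ + 1
  moveOne = solve-∀

φ-raise : ∀ φ μ r x → Pos μ → Corner r μ →
  φ (rowContent μ (raise r x)) ≡ φ (rowContent (delBox r μ) x) +ℤ δ x r * Δ φ μ r
φ-raise φ μ r x ps c with x ≟ r
... | no ne rewrite raise-neq r x ne | ≡ᵇ-false ne | part-delBox-ne r μ x ps c ne =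
      sym (trans (cong (φ (+ x - + part μ x) +ℤ_) (ZP.*-zeroˡ (Δ φ μ r))) (ZP.+-identityʳ _))
... | yes refl rewrite raise-eq x | ≡ᵇ-true {x} refl | part-delBox-eq x μ ps c
                     | content-pred x (part μ x) (NP.≤-<-trans z≤n c) =
      sym (addDifference (φ (rowContent μ (suc x))) (φ ((+ x - + part μ x) +ℤ + 1)))
  where
  addDifference : ∀ (b a : ℤ) → a +ℤ + 1 * (b - a) ≡ b
  addDifference = solve-∀

module MomentStep (φ : ℤ → ℤ) (m : ℕ) (IH : RowCountTheorem m) (μ : List ℕ) (P : IsPartition μ)
                  (e : sum μ ≡ suc m) (ts : List Tableau) (E : Enum (IsSYT μ) ts) where
  open Step m IH μ P e ts E public

  φ0 = φ (rowContent μ 0)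

  Σ-row-moment : ∀ r → Σl (sub r) (λ s → Σl (oneTo (suc (suc m))) (λ i → φ (rowContent μ (endRow (addEntry r (suc m) s) i))))
    ≡ (moment φ (delBox r μ) (sub r) m +ℤ K * Δ φ μ r) +ℤ φ0 * + length (sub r)
  Σ-row-moment r with Corner? r μ
  ... | no nc rewrite sub-empty r nc | Δ-not-corner φ μ r (partition⇒Decr μ P) nc | ZP.*-zeroʳ K | ZP.*-zeroʳ φ0 = refl
  ... | yes c = trans (Σ-row (φ ∘ rowContent μ) r) (cong (_+ℤ φ0 * + length (sub r)) (begin
      Σl (sub r) (λ s → Σl O (λ i → φ (rowContent μ (raise r (endRow s i)))))
    ≡⟨ Σl-ext (sub r) (λ s → Σl-ext O (λ i → φ-raise φ μ r (endRow s i) (proj₁ P) c)) ⟩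
      Σl (sub r) (λ s → Σl O (λ i → φ (rowContent μ' (endRow s i)) +ℤ δ (endRow s i) r * Δ φ μ r))
    ≡⟨ Σl-ext (sub r) (λ s → trans (Σl-+ O (λ i → φ (rowContent μ' (endRow s i))) (λ i → δ (endRow s i) r * Δ φ μ r)) (cong (Σl O (λ i → φ (rowContent μ' (endRow s i))) +ℤ_)
         (Σl-*ʳ O (λ i → δ (endRow s i) r) (Δ φ μ r)))) ⟩
      Σl (sub r) (λ s → Σl O (λ i → φ (rowContent μ' (endRow s i))) +ℤ Σl O (λ i → δ (endRow s i) r) * Δ φ μ r)
    ≡⟨ Σl-+ (sub r) _ _ ⟩
      moment φ μ' (sub r) m +ℤ Σl (sub r) (λ s → Σl O (λ i → δ (endRow s i) r) * Δ φ μ r)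
    ≡⟨ cong (moment φ μ' (sub r) m +ℤ_) (trans (Σl-*ʳ (sub r) _ (Δ φ μ r)) (cong (_* Δ φ μ r) (rowCount-corner r c))) ⟩
      moment φ μ' (sub r) m +ℤ K * Δ φ μ r
    ∎))
    where
    open ≡-Reasoning
    O = oneTo (suc m)
    μ' = delBox r μ

  moment-recursion : moment φ μ ts (suc m) ≡ Σr L (λ r → moment φ (delBox r μ) (sub r) m) +ℤ K * (Σr L (Δ φ μ) +ℤ φ0)
  moment-recursion = begin
      moment φ μ ts (suc m)
    ≡⟨ Σ-byRow _ L length≤L ⟩
      Σr L (λ r → Σl (sub r) (λ s → Σl (oneTo (suc (suc m))) (λ i → φ (rowContent μ (endRow (addEntry r (suc m) s) i)))))
    ≡⟨ Σr-ext L (λ r _ → Σ-row-moment r) ⟩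
      Σr L (λ r → (M r +ℤ K * Δ φ μ r) +ℤ φ0 * + length (sub r))
    ≡⟨ trans (Σr-+ L _ _) (cong₂ _+ℤ_ (Σr-+ L M (λ r → K * Δ φ μ r)) (Σr-*ˡ L φ0 _)) ⟩
      (Σr L M +ℤ Σr L (λ r → K * Δ φ μ r)) +ℤ φ0 * Σr L (λ r → + length (sub r))
    ≡⟨ cong₂ (λ x y → (Σr L M +ℤ x) +ℤ φ0 * y) (Σr-*ˡ L K (Δ φ μ)) (sym (count-byRow L length≤L)) ⟩
      (Σr L M +ℤ K * Σr L (Δ φ μ)) +ℤ φ0 * K
    ≡⟨ regroup (Σr L M) K (Σr L (Δ φ μ)) φ0 ⟩
      Σr L M +ℤ K * (Σr L (Δ φ μ) +ℤ φ0)
    ∎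
    where
    open ≡-Reasoning
    M : ℕ → ℤ
    M r = moment φ (delBox r μ) (sub r) m
    regroup : ∀ (x k y f : ℤ) → (x +ℤ k * y) +ℤ f * k ≡ x +ℤ k * (y +ℤ f)
    regroup = solve-∀

  Σ-moments : ∀ c → (∀ r → Corner r μ → moment φ (delBox r μ) (sub r) m ≡ c * + length (sub r)) →
    Σr L (λ r → moment φ (delBox r μ) (sub r) m) ≡ c * K
  Σ-moments c h = trans (Σr-ext L (λ r _ → row r)) (trans (Σr-*ˡ L c _) (cong (c *_) (sym (count-byRow L length≤L))))
    where
    row : ∀ r → moment φ (delBox r μ) (sub r) m ≡ c * + length (sub r)
    row r with Corner? r μ
    ... | yes cr = h r cr
    ... | no nc rewrite sub-empty r nc = sym (ZP.*-zeroʳ c)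

telescope-id : ∀ μ L → Σr L (Δ (λ x → x) μ) ≡ + part μ 0 - + part μ L
telescope-id μ zero = sym (ZP.+-inverseʳ (+ part μ 0))
telescope-id μ (suc L) rewrite telescope-id μ L = step (+ part μ 0) (+ part μ L) (+ part μ (suc L)) (+ L)
  where
  step : ∀ (a b c l : ℤ) → (a - b) +ℤ (((+ 1 +ℤ l) - c) - ((l - b) +ℤ + 1)) ≡ a - c
  step = solve-∀

sq : ℤ → ℤ
sq x = x * x

telescope-sq : ∀ μ L → Σr L (Δ sq μ) ≡ (sq (+ part μ L) - sq (+ part μ 0)) +ℤ + 2 * (Σr L (λ r → + part μ r) - + L * + part μ L)
telescope-sq μ zero = base (+ part μ 0)
  where
  base : ∀ (a : ℤ) → + 0 ≡ (a * a - a * a) +ℤ + 2 * (+ 0 - + 0 * a)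
  base = solve-∀
telescope-sq μ (suc L) rewrite telescope-sq μ L =
  step (+ part μ 0) (+ part μ L) (+ part μ (suc L)) (+ L) (Σr L (λ r → + part μ r))
  where
  step : ∀ (a b c l S : ℤ) →
    ((b * b - a * a) +ℤ + 2 * (S - l * b)) +ℤ (((+ 1 +ℤ l) - c) * ((+ 1 +ℤ l) - c) - ((l - b) +ℤ + 1) * ((l - b) +ℤ + 1))
    ≡ (c * c - a * a) +ℤ + 2 * ((S +ℤ b) - (+ 1 +ℤ l) * c)
  step = solve-∀

Σ-parts : ∀ μ L → length μ ≤ L → Σr L (λ r → + part μ r) ≡ + sum μ
Σ-parts [] L _ = Σr-0 L
Σ-parts (x ∷ μ) (suc L) (s≤s p) = trans (Σr-shift L (λ r → + part (x ∷ μ) r)) (cong (+ x +ℤ_) (Σ-parts μ L p))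

firstMoment : ∀ m μ → IsPartition μ → sum μ ≡ m → ∀ ts → Enum (IsSYT μ) ts → moment (λ x → x) μ ts m ≡ + 0
firstMoment zero μ P e ts E with enum-SYT-empty μ P e ts E
... | refl , refl = refl
firstMoment (suc m) μ P e ts E = begin
    moment (λ x → x) μ ts (suc m)
  ≡⟨ moment-recursion ⟩
    Σr L (λ r → moment (λ x → x) (delBox r μ) (sub r) m) +ℤ K * (Σr L (Δ (λ x → x) μ) +ℤ rowContent μ 0)
  ≡⟨ cong₂ (λ x y → x +ℤ K * (y +ℤ rowContent μ 0)) (Σ-moments (+ 0) smaller)
           (trans (telescope-id μ L) (cong (λ z → + part μ 0 - + z) (part-beyond μ L length≤L))) ⟩
    + 0 * K +ℤ K * ((+ part μ 0 - + 0) +ℤ (+ 0 - + part μ 0))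
  ≡⟨ vanish K (+ part μ 0) ⟩
    + 0
  ∎
  where
  open ≡-Reasoning
  open MomentStep (λ x → x) m (rowCount-theorem m) μ P e ts E
  smaller : ∀ r → Corner r μ → moment (λ x → x) (delBox r μ) (sub r) m ≡ + 0 * + length (sub r)
  smaller r c = firstMoment m (delBox r μ) (partition-delBox r μ P c) (sum-delBox-corner r μ m e c) (sub r) (sub-enum r c)
  vanish : ∀ (k a : ℤ) → + 0 * k +ℤ k * ((a - + 0) +ℤ (+ 0 - a)) ≡ + 0
  vanish = solve-∀

secondMoment : ∀ m μ → IsPartition μ → sum μ ≡ m → ∀ ts → Enum (IsSYT μ) ts →
  moment sq μ ts m ≡ + (m N.* suc m) * + length ts
secondMoment zero μ P e ts E with enum-SYT-empty μ P e ts E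
... | refl , refl = refl
secondMoment (suc m) μ P e ts E = begin
    moment sq μ ts (suc m)
  ≡⟨ moment-recursion ⟩
    Σr L (λ r → moment sq (delBox r μ) (sub r) m) +ℤ K * (Σr L (Δ sq μ) +ℤ φ0)
  ≡⟨ cong₂ (λ x y → x +ℤ K * (y +ℤ φ0)) (Σ-moments (+ (m N.* suc m)) smaller) telescope ⟩
    + (m N.* suc m) * K +ℤ K * (((sq (+ 0) - sq a) +ℤ + 2 * (+ suc m - + L * + 0)) +ℤ sq (+ 0 - a))
  ≡⟨ cong (λ z → z * K +ℤ K * (((sq (+ 0) - sq a) +ℤ + 2 * (+ suc m - + L * + 0)) +ℤ sq (+ 0 - a))) (ZP.pos-* m (suc m)) ⟩
    (+ m * + suc m) * K +ℤ K * (((sq (+ 0) - sq a) +ℤ + 2 * (+ suc m - + L * + 0)) +ℤ sq (+ 0 - a))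
  ≡⟨ simplify (+ m) a K (+ L) ⟩
    (+ suc m * + suc (suc m)) * K
  ≡⟨ cong (_* K) (sym (ZP.pos-* (suc m) (suc (suc m)))) ⟩
    + (suc m N.* suc (suc m)) * K
  ∎
  where
  open ≡-Reasoning
  open MomentStep sq m (rowCount-theorem m) μ P e ts E
  a = + part μ 0
  smaller : ∀ r → Corner r μ → moment sq (delBox r μ) (sub r) m ≡ + (m N.* suc m) * + length (sub r)
  smaller r c = secondMoment m (delBox r μ) (partition-delBox r μ P c) (sum-delBox-corner r μ m e c) (sub r) (sub-enum r c)
  telescope : Σr L (Δ sq μ) ≡ (sq (+ 0) - sq a) +ℤ + 2 * (+ suc m - + L * + 0)
  telescope = trans (telescope-sq μ L)
    (cong₂ (λ z w → (sq (+ z) - sq a) +ℤ + 2 * (w - + L * + z)) (part-beyond μ L length≤L)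
           (trans (Σ-parts μ L length≤L) (cong +_ e)))
  simplify : ∀ (M a k l : ℤ) →
    (M * (+ 1 +ℤ M)) * k +ℤ k * (((+ 0 * + 0 - a * a) +ℤ + 2 * ((+ 1 +ℤ M) - l * + 0)) +ℤ (+ 0 - a) * (+ 0 - a))
    ≡ ((+ 1 +ℤ M) * (+ 1 +ℤ (+ 1 +ℤ M))) * k
  simplify = solve-∀

sumOver-moment : ∀ (φ : ℤ → ℤ) lam ts → Enum (IsSYT lam) ts →
  sumOver ts (sum lam) (λ t i → φ (X t i)) ≡ moment φ lam ts (sum lam)
sumOver-moment φ lam ts E = trans (sumOver-Σ ts (sum lam) (λ t i → φ (X t i)))
  (Σl-cong ts (λ t mt → Σl-ext (oneTo (suc (sum lam))) (λ i →
    cong φ (trans (X-endRow t i) (cong (λ μ → rowContent μ (endRow t i)) (proj₁ (enum-to E mt)))))))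

-- with S1 = 0 and S2 = n (n + 1) f, the variance identity for N = f (n + 1)
variance : ∀ (f n : ℕ) → + (f N.* suc n) * (+ (n N.* suc n) * + f) - + 0 * + 0 ≡ + n * (+ (f N.* suc n) * + (f N.* suc n))
variance f n = begin
    + (f N.* suc n) * (+ (n N.* suc n) * + f) - + 0 * + 0
  ≡⟨ cong₂ (λ x y → x * (y * + f) - + 0 * + 0) (ZP.pos-* f (suc n)) (ZP.pos-* n (suc n)) ⟩
    (+ f * + suc n) * ((+ n * + suc n) * + f) - + 0 * + 0
  ≡⟨ identity (+ f) (+ n) ⟩
    + n * ((+ f * + suc n) * (+ f * + suc n))
  ≡⟨ cong (λ x → + n * (x * x)) (sym (ZP.pos-* f (suc n))) ⟩
    + n * (+ (f N.* suc n) * + (f N.* suc n))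
  ∎
  where
  open ≡-Reasoning
  identity : ∀ (a b : ℤ) → (a * (+ 1 +ℤ b)) * ((b * (+ 1 +ℤ b)) * a) - + 0 * + 0 ≡ b * ((a * (+ 1 +ℤ b)) * (a * (+ 1 +ℤ b)))
  identity = solve-∀

corollary6 : (lam : List ℕ) → IsPartition lam →
    (ts : List Tableau) → Unique ts → (∀ t → (t ∈ ts) ⇔ IsSYT lam t) →
    let n = sum lam
        N = + (length ts Data.Nat.* suc n)
        S1 = sumOver ts n X
        S2 = sumOver ts n (λ t i → X t i * X t i)
    in (S1 ≡ + 0) × (N * S2 - S1 * S1 ≡ + n * (N * N))
corollary6 lam P ts U mem = S1≡0 , varianceIdentity
  where
  E : Enum (IsSYT lam) ts
  E = U , mem
  S1≡0 : sumOver ts (sum lam) X ≡ + 0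
  S1≡0 = trans (sumOver-moment (λ x → x) lam ts E) (firstMoment (sum lam) lam P refl ts E)
  S2≡ : sumOver ts (sum lam) (λ t i → X t i * X t i) ≡ + (sum lam N.* suc (sum lam)) * + length ts
  S2≡ = trans (sumOver-moment sq lam ts E) (secondMoment (sum lam) lam P refl ts E)
  varianceIdentity : + (length ts N.* suc (sum lam)) * sumOver ts (sum lam) (λ t i → X t i * X t i)
                       - sumOver ts (sum lam) X * sumOver ts (sum lam) X
                     ≡ + sum lam * (+ (length ts N.* suc (sum lam)) * + (length ts N.* suc (sum lam)))
  varianceIdentity rewrite S1≡0 | S2≡ = variance (length ts) (sum lam)
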